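{- Suppose the EEC computation type $\underline R$ is either a computation-type constant or $\underline I$, and let $(\cdot)^\bullet,(\cdot)^\circ$ be the generic self-translation relative to $\underline R$. Then: (1) If $\Gamma\mid-\vdash t:A$, $\Gamma\mid-\vdash u:A$ and $\Gamma^\bullet\mid-\vdash t^\bullet=u^\bullet:A^\bullet$, then $\Gamma\mid-\vdash t=u:A$. (2) If $\Gamma^\bullet\mid-\vdash t:A^\bullet$, then there exists $\Gamma\mid-\vdash u:A$ with $\Gamma^\bullet\mid-\vdash t=u^\bullet:A^\bullet$. (3) If $\Gamma\mid z{:}\underline A\vdash t:\underline B$, $\Gamma\mid z{:}\underline A\vdash u:\underline B$ and $\Gamma^\bullet\mid k_z{:}\underline B^\circ\vdash t^\circ=u^\circ:\underline A^\circ$, then $\Gamma\mid z{:}\underline A\vdash t=u:\underline B$. (4) If $\Gamma^\bullet\mid k_z{:}\underline B^\circ\vdash t:\underline A^\circ$, then there exists $\Gamma\mid z{:}\underline A\vdash u:\underline B$ with $\Gamma^\bullet\mid k_z{:}\underline B^\circ\vdash t=u^\circ:\underline A^\circ$.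
   Context: **EEC (enriched effect calculus).** There are value-type constants $\alpha,\beta,\ldots$ and a disjoint set of computation-type constants $\underline{\alpha},\underline{\beta},\ldots$. Value types $A,B,C$ and computation types $\underline{A},\underline{B},\underline{C},\underline{D}$ are generated by $A::=\alpha\mid 1\mid A\times B\mid A\to B\mid \underline{A}\mid \underline{A}\multimap\underline{B}$ and $\underline{A}::=\underline{\alpha}\mid\underline{1}\mid\underline{A}\,\&\,\underline{B}\mid A\Rightarrow\underline{B}\mid\underline{I}\mid\ !A\mid\ !A\otimes\underline{B}\mid\underline{0}\mid\underline{A}\oplus\underline{B}$ (every computation type is also a value type; $!A\otimes\underline{B}$ is one primitive binary constructor). Judgements are $\Gamma\mid -\vdash t:A$ and $\Gamma\mid z{:}\underline{A}\vdash t:\underline{B}$, where $\Gamma$ lists distinct variables with value types and the "stoup" holds at most one variable, of computation type; with nonempty stoup the result type is a computation type. Below $\Delta$ is empty or $z{:}\underline{D}$. Typing rules: $\Gamma,x{:}A\mid-\vdash x:A$; $\Gamma\mid-\vdash *:1$; pairs $\langle t,u\rangle:A\times B$, projections $\pi_1t,\pi_2t$; $\lambda x{:}A.t:A\to B$ from $\Gamma,x{:}A\mid-\vdash t:B$; application $t\,u$ (all with empty stoup). $\Gamma\mid z{:}\underline A\vdash z:\underline A$; $\Gamma\mid\Delta\vdash\underline{*}:\underline 1$; from $\Gamma\mid\Delta\vdash t:\underline A$, $\Gamma\mid\Delta\vdash u:\underline B$ get $\Gamma\mid\Delta\vdash\langle t,u\rangle_c:\underline A\,\&\,\underline B$, and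 from $\Gamma\mid\Delta\vdash t:\underline A\,\&\,\underline B$ get $\underline\pi_1t:\underline A$, $\underline\pi_2t:\underline B$; from $\Gamma,x{:}A\mid\Delta\vdash t:\underline B$ get $\Gamma\mid\Delta\vdash\underline\lambda x{:}A.t:A\Rightarrow\underline B$; from $\Gamma\mid\Delta\vdash s:A\Rightarrow\underline B$, $\Gamma\mid-\vdash t:A$ get $\Gamma\mid\Delta\vdash s@t:\underline B$; $\Gamma\mid-\vdash\top:\underline I$; from $\Gamma\mid\Delta\vdash t:\underline I$, $\Gamma\mid-\vdash u:\underline A$ get $\Gamma\mid\Delta\vdash \mathrm{let}\ \top\ \mathrm{be}\ t\ \mathrm{in}\ u:\underline A$; from $\Gamma\mid-\vdash t:A$ get $\Gamma\mid-\vdash\,!t:\,!A$; from $\Gamma\mid\Delta\vdash t:\,!A$, $\Gamma,x{:}A\mid-\vdash u:\underline B$ get $\Gamma\mid\Delta\vdash\mathrm{let}\ !x\ \mathrm{be}\ t\ \mathrm{in}\ u:\underline B$; from $\Gamma\mid-\vdash t:A$, $\Gamma\mid\Delta\vdash u:\underline B$ get $\Gamma\mid\Delta\vdash\,!t\otimes u:\,!A\otimes\underline B$; from $\Gamma\mid\Delta\vdash s:\,!A\otimes\underline B$, $\Gamma,x{:}A\mid y{:}\underline B\vdash t:\underline C$ get $\Gamma\mid\Delta\vdash\mathrm{let}\ !x\otimes y\ \mathrm{be}\ s\ \mathrm{in}\ t:\underline C$; from $\Gamma\mid\Delta\vdash t:\underline 0$ get $\Gamma\mid\Delta\vdash\mathrm{abort}_{\underline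 A}(t):\underline A$; $\mathrm{inl}\,t:\underline A\oplus\underline B$ from $t:\underline A$ and $\mathrm{inr}\,t$ from $t:\underline B$ (same $\Gamma\mid\Delta$); from $\Gamma\mid\Delta\vdash s:\underline A\oplus\underline B$, $\Gamma\mid x{:}\underline A\vdash t:\underline C$, $\Gamma\mid y{:}\underline B\vdash u:\underline C$ get $\Gamma\mid\Delta\vdash\mathrm{case}\ s\ \mathrm{of}\ (\mathrm{inl}\,x\Rightarrow t\mid\mathrm{inr}\,y\Rightarrow u):\underline C$; from $\Gamma\mid z{:}\underline A\vdash t:\underline B$ get $\Gamma\mid-\vdash\hat\lambda z{:}\underline A.t:\underline A\multimap\underline B$; from $\Gamma\mid-\vdash s:\underline A\multimap\underline B$, $\Gamma\mid\Delta\vdash t:\underline A$ get $\Gamma\mid\Delta\vdash s\{t\}:\underline B$. Equality $\Gamma\mid\Delta\vdash t=u:A$ is the least typed congruence (equivalence, compatible with all term formers, containing $\alpha$-equivalence) containing all well-typed instances of: $t=*$ for $t:1$; $\pi_1\langle t,u\rangle=t$, $\pi_2\langle t,u\rangle=u$, $\langle\pi_1t,\pi_2t\rangle=t$; $(\lambda x.t)u=t[u/x]$, $\lambda x.(t\,x)=t$ ($x$ not free in $t$); $t=\underline*$ for $t:\underline1$; $\underline\pi_1\langle t,u\rangle_c=t$, $\underline\pi_2\langle t,u\rangle_c=u$, $\langle\underline\pi_1t,\underline\pi_2t\rangle_c=t$; $(\underline\lambda x.t)@u=t[u/x]$, $\underline\lambda x.(t@x)=t$ ($x$ not free); $\mathrm{let}\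 \top\ \mathrm{be}\ \top\ \mathrm{in}\ t=t$; $\mathrm{let}\ \top\ \mathrm{be}\ t\ \mathrm{in}\ u[\top/x]=u[t/x]$ for $\Gamma\mid x{:}\underline I\vdash u:\underline A$; $\mathrm{let}\ !x\ \mathrm{be}\ !t\ \mathrm{in}\ u=u[t/x]$; $\mathrm{let}\ !x\ \mathrm{be}\ t\ \mathrm{in}\ u[!x/y]=u[t/y]$ for $\Gamma\mid y{:}\,!A\vdash u:\underline B$; $\mathrm{let}\ !x\otimes y\ \mathrm{be}\ !t\otimes s\ \mathrm{in}\ u=u[t/x,s/y]$; $\mathrm{let}\ !x\otimes y\ \mathrm{be}\ t\ \mathrm{in}\ u[(!x\otimes y)/z]=u[t/z]$ for $\Gamma\mid z{:}\,!A\otimes\underline B\vdash u:\underline C$; $\mathrm{abort}_{\underline A}(t)=u[t/x]$ for $\Gamma\mid x{:}\underline 0\vdash u:\underline A$; $\mathrm{case}\ \mathrm{inl}\,t\ \mathrm{of}\ (\mathrm{inl}\,x\Rightarrow u\mid\mathrm{inr}\,y\Rightarrow u')=u[t/x]$ and symmetrically for $\mathrm{inr}$; $\mathrm{case}\ t\ \mathrm{of}\ (\mathrm{inl}\,x\Rightarrow u[\mathrm{inl}\,x/z]\mid\mathrm{inr}\,y\Rightarrow u[\mathrm{inr}\,y/z])=u[t/z]$ for $\Gamma\mid z{:}\underline A\oplus\underline B\vdash u:\underline C$; $(\hat\lambda x.t)\{u\}=t[u/x]$, $\hat\lambda x.(t\{x\})=t$ ($x$ not free). **Generic self-translation relative to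 a computation type $\underline R$.** Types: $\alpha^\bullet=\alpha$, $1^\bullet=1$, $(A\times B)^\bullet=A^\bullet\times B^\bullet$, $(A\to B)^\bullet=A^\bullet\to B^\bullet$, $\underline A^\bullet=\underline A^\circ\multimap\underline R$ (a computation type viewed as a value type), $(\underline A\multimap\underline B)^\bullet=\underline B^\circ\multimap\underline A^\circ$; $\underline\alpha^\circ=\underline\alpha$ if $\underline\alpha\neq\underline R$ and $\underline\alpha^\circ=\underline I$ if $\underline R$ is the constant $\underline\alpha$; $\underline1^\circ=\underline0$; $(\underline A\,\&\,\underline B)^\circ=\underline A^\circ\oplus\underline B^\circ$; $(A\Rightarrow\underline B)^\circ=\,!(A^\bullet)\otimes\underline B^\circ$; $\underline I^\circ=\underline R$; $(!A)^\circ=A^\bullet\Rightarrow\underline R$; $(!A\otimes\underline B)^\circ=A^\bullet\Rightarrow\underline B^\circ$; $\underline0^\circ=\underline1$; $(\underline A\oplus\underline B)^\circ=\underline A^\circ\,\&\,\underline B^\circ$. For $\Gamma=x_1{:}C_1,\ldots,x_n{:}C_n$, $\Gamma^\bullet=x_1{:}C_1^\bullet,\ldots,x_n{:}C_n^\bullet$. To each variable $z$ is associated a distinct fresh variable $k_z$ (so iterating gives $k_{k_z}$); $k,h,k_x,k_y$ below are fresh bound variables. Terms: a judgement $\Gamma\mid-\vdash t:A$ goes to $\Gamma^\bullet\mid-\vdash t^\bullet:A^\bullet$, and $\Gamma\mid z{:}\underline D\vdash t:\underline B$ goes to $\Gamma^\bullet\mid k_z{:}\underline B^\circ\vdash t^\circ:\underline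 D^\circ$ (contravariantly); type names below refer to the typing rules. Value clauses: $x^\bullet=x$; $*^\bullet=*$; $\langle t,u\rangle^\bullet=\langle t^\bullet,u^\bullet\rangle$; $(\pi_it)^\bullet=\pi_it^\bullet$; $(\lambda x{:}A.t)^\bullet=\lambda x{:}A^\bullet.t^\bullet$; $(t\,u)^\bullet=t^\bullet\,u^\bullet$; $\underline*^\bullet=\hat\lambda k{:}\underline0.\,\mathrm{abort}_{\underline R}(k)$; $\langle t,u\rangle_c^\bullet=\hat\lambda k{:}\underline A^\circ\oplus\underline B^\circ.\,\mathrm{case}\ k\ \mathrm{of}\ (\mathrm{inl}\,k_x\Rightarrow t^\bullet\{k_x\}\mid\mathrm{inr}\,k_y\Rightarrow u^\bullet\{k_y\})$; $(\underline\pi_1t)^\bullet=\hat\lambda k{:}\underline A^\circ.\,t^\bullet\{\mathrm{inl}\,k\}$; $(\underline\pi_2t)^\bullet=\hat\lambda k{:}\underline B^\circ.\,t^\bullet\{\mathrm{inr}\,k\}$; $(\underline\lambda x{:}A.t)^\bullet=\hat\lambda k{:}\,!A^\bullet\otimes\underline B^\circ.\,\mathrm{let}\ !x\otimes h\ \mathrm{be}\ k\ \mathrm{in}\ t^\bullet\{h\}$; $(s@t)^\bullet=\hat\lambda k{:}\underline B^\circ.\,s^\bullet\{!(t^\bullet)\otimes k\}$; $\top^\bullet=\hat\lambda k{:}\underline R.\,k$; $(\mathrm{let}\ \top\ \mathrm{be}\ t\ \mathrm{in}\ u)^\bullet=\hat\lambda k{:}\underline A^\circ.\,t^\bullet\{u^\bullet\{k\}\}$;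 $(!t)^\bullet=\hat\lambda k{:}A^\bullet\Rightarrow\underline R.\,k@t^\bullet$; $(\mathrm{let}\ !x\ \mathrm{be}\ t\ \mathrm{in}\ u)^\bullet=\hat\lambda k{:}\underline B^\circ.\,t^\bullet\{\underline\lambda x{:}A^\bullet.\,u^\bullet\{k\}\}$; $(!t\otimes u)^\bullet=\hat\lambda k{:}A^\bullet\Rightarrow\underline B^\circ.\,u^\bullet\{k@t^\bullet\}$; $(\mathrm{let}\ !x\otimes y\ \mathrm{be}\ s\ \mathrm{in}\ t)^\bullet=\hat\lambda k{:}\underline C^\circ.\,s^\bullet\{\underline\lambda x{:}A^\bullet.\,t^\circ[k/k_y]\}$; $(\mathrm{abort}_{\underline A}(t))^\bullet=\hat\lambda k{:}\underline A^\circ.\,t^\bullet\{\underline*\}$; $(\mathrm{inl}\,t)^\bullet=\hat\lambda k{:}\underline A^\circ\,\&\,\underline B^\circ.\,t^\bullet\{\underline\pi_1k\}$; $(\mathrm{inr}\,t)^\bullet=\hat\lambda k{:}\underline A^\circ\,\&\,\underline B^\circ.\,t^\bullet\{\underline\pi_2k\}$; $(\mathrm{case}\ s\ \mathrm{of}\ (\mathrm{inl}\,x\Rightarrow t\mid\mathrm{inr}\,y\Rightarrow u))^\bullet=\hat\lambda k{:}\underline C^\circ.\,s^\bullet\{\langle t^\circ[k/k_x],u^\circ[k/k_y]\rangle_c\}$; $(\hat\lambda z{:}\underline A.t)^\bullet=\hat\lambda k{:}\underline B^\circ.\,t^\circ[k/k_z]$; $(s\{t\})^\bullet=\hat\lambda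 k{:}\underline B^\circ.\,t^\bullet\{s^\bullet\{k\}\}$. Computation clauses (stoup $z{:}\underline D$): $z^\circ=k_z$; $\underline*^\circ=\mathrm{abort}_{\underline D^\circ}(k_z)$; $\langle t,u\rangle_c^\circ=\mathrm{case}\ k_z\ \mathrm{of}\ (\mathrm{inl}\,k_x\Rightarrow t^\circ[k_x/k_z]\mid\mathrm{inr}\,k_y\Rightarrow u^\circ[k_y/k_z])$; $(\underline\pi_1t)^\circ=t^\circ[\mathrm{inl}\,k_z/k_z]$; $(\underline\pi_2t)^\circ=t^\circ[\mathrm{inr}\,k_z/k_z]$; $(\underline\lambda x{:}A.t)^\circ=\mathrm{let}\ !x\otimes h\ \mathrm{be}\ k_z\ \mathrm{in}\ t^\circ[h/k_z]$; $(s@t)^\circ=s^\circ[(!(t^\bullet)\otimes k_z)/k_z]$; $(\mathrm{let}\ \top\ \mathrm{be}\ t\ \mathrm{in}\ u)^\circ=t^\circ[u^\bullet\{k_z\}/k_z]$; $(\mathrm{let}\ !x\ \mathrm{be}\ t\ \mathrm{in}\ u)^\circ=t^\circ[(\underline\lambda x{:}A^\bullet.\,u^\bullet\{k_z\})/k_z]$; $(!t\otimes u)^\circ=u^\circ[(k_z@t^\bullet)/k_z]$; $(\mathrm{let}\ !x\otimes y\ \mathrm{be}\ s\ \mathrm{in}\ t)^\circ=s^\circ[(\underline\lambda x{:}A^\bullet.\,t^\circ[k_z/k_y])/k_z]$; $(\mathrm{abort}(t))^\circ=t^\circ[\underline*/k_z]$; $(\mathrm{inl}\,t)^\circ=t^\circ[\underline\pi_1k_z/k_z]$;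 $(\mathrm{inr}\,t)^\circ=t^\circ[\underline\pi_2k_z/k_z]$; $(\mathrm{case}\ s\ \mathrm{of}\ (\mathrm{inl}\,x\Rightarrow t\mid\mathrm{inr}\,y\Rightarrow u))^\circ=s^\circ[\langle t^\circ[k_z/k_x],u^\circ[k_z/k_y]\rangle_c/k_z]$; $(s\{t\})^\circ=t^\circ[s^\bullet\{k_z\}/k_z]$. -}

module Defs where

open import Data.Nat using (ℕ; _≡ᵇ_)
open import Data.Bool using (Bool; true; false; if_then_else_)
open import Data.List using (List; []; _∷_; map)
open import Data.Maybe using (Maybe; just; nothing)

-- EEC types.  Value-type constants and computation-type constants are
-- indexed by ℕ (two disjoint supplies).  Every computation type is a
-- value type via ⌜_⌝.

infixr 30 _×ᵥ_ _&_ _⊕_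
infixr 25 _→ᵥ_ _⇒_ _⊸_
infix 40 !_
infix 35 !_⊗_

data VTy : Set
data CTy : Set

data VTy where
  vcon  : ℕ → VTy
  one   : VTy
  _×ᵥ_  : VTy → VTy → VTy
  _→ᵥ_  : VTy → VTy → VTy
  ⌜_⌝   : CTy → VTy
  _⊸_   : CTy → CTy → VTy

data CTy where
  ccon  : ℕ → CTy
  One   : CTy
  _&_   : CTy → CTy → CTy
  _⇒_   : VTy → CTy → CTy
  I     : CTy
  !_    : VTy → CTy
  !_⊗_  : VTy → CTy → CTy
  Zero  : CTy
  _⊕_   : CTy → CTy → CTy

-- Contexts (de Bruijn, newest variable at the head) and stoups.

Ctx : Set
Ctx = List VTy

Stoup : Set
Stoup = Maybe CTy

infix 4 _∋_
data _∋_ : Ctx → VTy → Set where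
  here  : ∀ {Γ A} → (A ∷ Γ) ∋ A
  there : ∀ {Γ A B} → Γ ∋ A → (B ∷ Γ) ∋ A

variable
  Γ Γ' : Ctx
  Δ : Stoup
  A B C : VTy
  P Q S D : CTy

-- Intrinsically typed EEC terms:  Tm Γ Δ A  is  Γ | Δ ⊢ t : A
-- (Δ = nothing: empty stoup; Δ = just D: stoup z : D).

data Tm : Ctx → Stoup → VTy → Set where
  var     : Γ ∋ A → Tm Γ nothing A
  unit    : Tm Γ nothing one
  pair    : Tm Γ nothing A → Tm Γ nothing B → Tm Γ nothing (A ×ᵥ B)
  fst     : Tm Γ nothing (A ×ᵥ B) → Tm Γ nothing A
  snd     : Tm Γ nothing (A ×ᵥ B) → Tm Γ nothing B
  lam     : Tm (A ∷ Γ) nothing B → Tm Γ nothing (A →ᵥ B)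
  app     : Tm Γ nothing (A →ᵥ B) → Tm Γ nothing A → Tm Γ nothing B
  stoup   : Tm Γ (just P) ⌜ P ⌝
  cunit   : Tm Γ Δ ⌜ One ⌝
  cpair   : Tm Γ Δ ⌜ P ⌝ → Tm Γ Δ ⌜ Q ⌝ → Tm Γ Δ ⌜ P & Q ⌝
  cfst    : Tm Γ Δ ⌜ P & Q ⌝ → Tm Γ Δ ⌜ P ⌝
  csnd    : Tm Γ Δ ⌜ P & Q ⌝ → Tm Γ Δ ⌜ Q ⌝
  clam    : Tm (A ∷ Γ) Δ ⌜ Q ⌝ → Tm Γ Δ ⌜ A ⇒ Q ⌝
  capp    : Tm Γ Δ ⌜ A ⇒ Q ⌝ → Tm Γ nothing A → Tm Γ Δ ⌜ Q ⌝
  top     : Tm Γ nothing ⌜ I ⌝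
  letTop  : Tm Γ Δ ⌜ I ⌝ → Tm Γ nothing ⌜ P ⌝ → Tm Γ Δ ⌜ P ⌝
  bang    : Tm Γ nothing A → Tm Γ nothing ⌜ ! A ⌝
  letBang : Tm Γ Δ ⌜ ! A ⌝ → Tm (A ∷ Γ) nothing ⌜ Q ⌝ → Tm Γ Δ ⌜ Q ⌝
  tens    : Tm Γ nothing A → Tm Γ Δ ⌜ Q ⌝ → Tm Γ Δ ⌜ ! A ⊗ Q ⌝
  letTens : Tm Γ Δ ⌜ ! A ⊗ Q ⌝ → Tm (A ∷ Γ) (just Q) ⌜ S ⌝ → Tm Γ Δ ⌜ S ⌝
  abort   : Tm Γ Δ ⌜ Zero ⌝ → Tm Γ Δ ⌜ P ⌝
  inl     : Tm Γ Δ ⌜ P ⌝ → Tm Γ Δ ⌜ P ⊕ Q ⌝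
  inr     : Tm Γ Δ ⌜ Q ⌝ → Tm Γ Δ ⌜ P ⊕ Q ⌝
  case    : Tm Γ Δ ⌜ P ⊕ Q ⌝ → Tm Γ (just P) ⌜ S ⌝ → Tm Γ (just Q) ⌜ S ⌝ → Tm Γ Δ ⌜ S ⌝
  hlam    : Tm Γ (just P) ⌜ Q ⌝ → Tm Γ nothing (P ⊸ Q)
  lapp    : Tm Γ nothing (P ⊸ Q) → Tm Γ Δ ⌜ P ⌝ → Tm Γ Δ ⌜ Q ⌝

Ren : Ctx → Ctx → Set
Ren Γ Γ' = ∀ {A} → Γ ∋ A → Γ' ∋ A

extR : Ren Γ Γ' → Ren (A ∷ Γ) (A ∷ Γ')
extR ρ here = here
extR ρ (there x) = there (ρ x)

ren : Ren Γ Γ' → Tm Γ Δ A → Tm Γ' Δ A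
ren ρ (var x) = var (ρ x)
ren ρ unit = unit
ren ρ (pair t u) = pair (ren ρ t) (ren ρ u)
ren ρ (fst t) = fst (ren ρ t)
ren ρ (snd t) = snd (ren ρ t)
ren ρ (lam t) = lam (ren (extR ρ) t)
ren ρ (app t u) = app (ren ρ t) (ren ρ u)
ren ρ stoup = stoup
ren ρ cunit = cunit
ren ρ (cpair t u) = cpair (ren ρ t) (ren ρ u)
ren ρ (cfst t) = cfst (ren ρ t)
ren ρ (csnd t) = csnd (ren ρ t)
ren ρ (clam t) = clam (ren (extR ρ) t)
ren ρ (capp t u) = capp (ren ρ t) (ren ρ u)
ren ρ top = top
ren ρ (letTop t u) = letTop (ren ρ t) (ren ρ u)
ren ρ (bang t) = bang (ren ρ t)
ren ρ (letBang t u) = letBang (ren ρ t) (ren (extR ρ) u)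
ren ρ (tens t u) = tens (ren ρ t) (ren ρ u)
ren ρ (letTens t u) = letTens (ren ρ t) (ren (extR ρ) u)
ren ρ (abort t) = abort (ren ρ t)
ren ρ (inl t) = inl (ren ρ t)
ren ρ (inr t) = inr (ren ρ t)
ren ρ (case s t u) = case (ren ρ s) (ren ρ t) (ren ρ u)
ren ρ (hlam t) = hlam (ren ρ t)
ren ρ (lapp t u) = lapp (ren ρ t) (ren ρ u)

wk : Tm Γ Δ A → Tm (B ∷ Γ) Δ A
wk = ren there

Sub : Ctx → Ctx → Set
Sub Γ Γ' = ∀ {A} → Γ ∋ A → Tm Γ' nothing A

extS : Sub Γ Γ' → Sub (A ∷ Γ) (A ∷ Γ')
extS σ here = var here
extS σ (there x) = wk (σ x)

sub : Sub Γ Γ' → Tm Γ Δ A → Tm Γ' Δ A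
sub σ (var x) = σ x
sub σ unit = unit
sub σ (pair t u) = pair (sub σ t) (sub σ u)
sub σ (fst t) = fst (sub σ t)
sub σ (snd t) = snd (sub σ t)
sub σ (lam t) = lam (sub (extS σ) t)
sub σ (app t u) = app (sub σ t) (sub σ u)
sub σ stoup = stoup
sub σ cunit = cunit
sub σ (cpair t u) = cpair (sub σ t) (sub σ u)
sub σ (cfst t) = cfst (sub σ t)
sub σ (csnd t) = csnd (sub σ t)
sub σ (clam t) = clam (sub (extS σ) t)
sub σ (capp t u) = capp (sub σ t) (sub σ u)
sub σ top = top
sub σ (letTop t u) = letTop (sub σ t) (sub σ u)
sub σ (bang t) = bang (sub σ t)
sub σ (letBang t u) = letBang (sub σ t) (sub (extS σ) u)
sub σ (tens t u) = tens (sub σ t) (sub σ u)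
sub σ (letTens t u) = letTens (sub σ t) (sub (extS σ) u)
sub σ (abort t) = abort (sub σ t)
sub σ (inl t) = inl (sub σ t)
sub σ (inr t) = inr (sub σ t)
sub σ (case s t u) = case (sub σ s) (sub σ t) (sub σ u)
sub σ (hlam t) = hlam (sub σ t)
sub σ (lapp t u) = lapp (sub σ t) (sub σ u)

single : Tm Γ nothing A → Sub (A ∷ Γ) Γ
single u here = u
single u (there x) = var x

_[_] : Tm (A ∷ Γ) Δ B → Tm Γ nothing A → Tm Γ Δ B
t [ u ] = sub (single u) t

_[_]ₛ : Tm Γ (just D) A → Tm Γ Δ ⌜ D ⌝ → Tm Γ Δ A
stoup [ s ]ₛ = s
cunit [ s ]ₛ = cunit
cpair t u [ s ]ₛ = cpair (t [ s ]ₛ) (u [ s ]ₛ)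
cfst t [ s ]ₛ = cfst (t [ s ]ₛ)
csnd t [ s ]ₛ = csnd (t [ s ]ₛ)
clam t [ s ]ₛ = clam (t [ wk s ]ₛ)
capp t u [ s ]ₛ = capp (t [ s ]ₛ) u
letTop t u [ s ]ₛ = letTop (t [ s ]ₛ) u
letBang t u [ s ]ₛ = letBang (t [ s ]ₛ) u
tens t u [ s ]ₛ = tens t (u [ s ]ₛ)
letTens t u [ s ]ₛ = letTens (t [ s ]ₛ) u
abort t [ s ]ₛ = abort (t [ s ]ₛ)
inl t [ s ]ₛ = inl (t [ s ]ₛ)
inr t [ s ]ₛ = inr (t [ s ]ₛ)
case r t u [ s ]ₛ = case (r [ s ]ₛ) t u
lapp t u [ s ]ₛ = lapp t (u [ s ]ₛ)

-- Equality  Γ | Δ ⊢ t = u : A : the least typed congruence containing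
-- the listed axioms (α-equivalence is built in via de Bruijn indices).

infix 4 _≈_
data _≈_ : Tm Γ Δ A → Tm Γ Δ A → Set where
  ≈-refl  : {t : Tm Γ Δ A} → t ≈ t
  ≈-sym   : {t u : Tm Γ Δ A} → t ≈ u → u ≈ t
  ≈-trans : {t u v : Tm Γ Δ A} → t ≈ u → u ≈ v → t ≈ v
  pair-cong    : {t t' : Tm Γ nothing A} {u u' : Tm Γ nothing B} → t ≈ t' → u ≈ u' → pair t u ≈ pair t' u'
  fst-cong     : {t t' : Tm Γ nothing (A ×ᵥ B)} → t ≈ t' → fst t ≈ fst t'
  snd-cong     : {t t' : Tm Γ nothing (A ×ᵥ B)} → t ≈ t' → snd t ≈ snd t'
  lam-cong     : {t t' : Tm (A ∷ Γ) nothing B} → t ≈ t' → lam t ≈ lam t'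
  app-cong     : {t t' : Tm Γ nothing (A →ᵥ B)} {u u' : Tm Γ nothing A} → t ≈ t' → u ≈ u' → app t u ≈ app t' u'
  cpair-cong   : {t t' : Tm Γ Δ ⌜ P ⌝} {u u' : Tm Γ Δ ⌜ Q ⌝} → t ≈ t' → u ≈ u' → cpair t u ≈ cpair t' u'
  cfst-cong    : {t t' : Tm Γ Δ ⌜ P & Q ⌝} → t ≈ t' → cfst t ≈ cfst t'
  csnd-cong    : {t t' : Tm Γ Δ ⌜ P & Q ⌝} → t ≈ t' → csnd t ≈ csnd t'
  clam-cong    : {t t' : Tm (A ∷ Γ) Δ ⌜ Q ⌝} → t ≈ t' → clam t ≈ clam t'
  capp-cong    : {t t' : Tm Γ Δ ⌜ A ⇒ Q ⌝} {u u' : Tm Γ nothing A} → t ≈ t' → u ≈ u' → capp t u ≈ capp t' u'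
  letTop-cong  : {t t' : Tm Γ Δ ⌜ I ⌝} {u u' : Tm Γ nothing ⌜ P ⌝} → t ≈ t' → u ≈ u' → letTop t u ≈ letTop t' u'
  bang-cong    : {t t' : Tm Γ nothing A} → t ≈ t' → bang t ≈ bang t'
  letBang-cong : {t t' : Tm Γ Δ ⌜ ! A ⌝} {u u' : Tm (A ∷ Γ) nothing ⌜ Q ⌝} → t ≈ t' → u ≈ u' → letBang t u ≈ letBang t' u'
  tens-cong    : {t t' : Tm Γ nothing A} {u u' : Tm Γ Δ ⌜ Q ⌝} → t ≈ t' → u ≈ u' → tens t u ≈ tens t' u'
  letTens-cong : {t t' : Tm Γ Δ ⌜ ! A ⊗ Q ⌝} {u u' : Tm (A ∷ Γ) (just Q) ⌜ S ⌝} → t ≈ t' → u ≈ u' → letTens t u ≈ letTens t' u'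
  abort-cong   : {t t' : Tm Γ Δ ⌜ Zero ⌝} → t ≈ t' → abort {P = P} t ≈ abort t'
  inl-cong     : {t t' : Tm Γ Δ ⌜ P ⌝} → t ≈ t' → inl {Q = Q} t ≈ inl t'
  inr-cong     : {t t' : Tm Γ Δ ⌜ Q ⌝} → t ≈ t' → inr {P = P} t ≈ inr t'
  case-cong    : {s s' : Tm Γ Δ ⌜ P ⊕ Q ⌝} {t t' : Tm Γ (just P) ⌜ S ⌝} {u u' : Tm Γ (just Q) ⌜ S ⌝} → s ≈ s' → t ≈ t' → u ≈ u' → case s t u ≈ case s' t' u'
  hlam-cong    : {t t' : Tm Γ (just P) ⌜ Q ⌝} → t ≈ t' → hlam t ≈ hlam t'
  lapp-cong    : {t t' : Tm Γ nothing (P ⊸ Q)} {u u' : Tm Γ Δ ⌜ P ⌝} → t ≈ t' → u ≈ u' → lapp t u ≈ lapp t' u'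
  one-η     : (t : Tm Γ nothing one) → t ≈ unit
  fst-β     : (t : Tm Γ nothing A) (u : Tm Γ nothing B) → fst (pair t u) ≈ t
  snd-β     : (t : Tm Γ nothing A) (u : Tm Γ nothing B) → snd (pair t u) ≈ u
  pair-η    : (t : Tm Γ nothing (A ×ᵥ B)) → pair (fst t) (snd t) ≈ t
  lam-β     : (t : Tm (A ∷ Γ) nothing B) (u : Tm Γ nothing A) → app (lam t) u ≈ t [ u ]
  lam-η     : (t : Tm Γ nothing (A →ᵥ B)) → lam (app (wk t) (var here)) ≈ t
  One-η     : (t : Tm Γ Δ ⌜ One ⌝) → t ≈ cunit
  cfst-β    : (t : Tm Γ Δ ⌜ P ⌝) (u : Tm Γ Δ ⌜ Q ⌝) → cfst (cpair t u) ≈ t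
  csnd-β    : (t : Tm Γ Δ ⌜ P ⌝) (u : Tm Γ Δ ⌜ Q ⌝) → csnd (cpair t u) ≈ u
  cpair-η   : (t : Tm Γ Δ ⌜ P & Q ⌝) → cpair (cfst t) (csnd t) ≈ t
  clam-β    : (t : Tm (A ∷ Γ) Δ ⌜ Q ⌝) (u : Tm Γ nothing A) → capp (clam t) u ≈ t [ u ]
  clam-η    : (t : Tm Γ Δ ⌜ A ⇒ Q ⌝) → clam (capp (wk t) (var here)) ≈ t
  letTop-β  : (t : Tm Γ nothing ⌜ P ⌝) → letTop top t ≈ t
  letTop-η  : (t : Tm Γ Δ ⌜ I ⌝) (u : Tm Γ (just I) ⌜ P ⌝) → letTop t (u [ top ]ₛ) ≈ u [ t ]ₛ
  letBang-β : (t : Tm Γ nothing A) (u : Tm (A ∷ Γ) nothing ⌜ Q ⌝) → letBang (bang t) u ≈ u [ t ]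
  letBang-η : (t : Tm Γ Δ ⌜ ! A ⌝) (u : Tm Γ (just (! A)) ⌜ Q ⌝) →
              letBang t (wk u [ bang (var here) ]ₛ) ≈ u [ t ]ₛ
  letTens-β : (t : Tm Γ nothing A) (s : Tm Γ Δ ⌜ Q ⌝) (u : Tm (A ∷ Γ) (just Q) ⌜ S ⌝) →
              letTens (tens t s) u ≈ (u [ t ]) [ s ]ₛ
  letTens-η : (t : Tm Γ Δ ⌜ ! A ⊗ Q ⌝) (u : Tm Γ (just (! A ⊗ Q)) ⌜ S ⌝) →
              letTens t (wk u [ tens (var here) stoup ]ₛ) ≈ u [ t ]ₛ
  abort-η   : (t : Tm Γ Δ ⌜ Zero ⌝) (u : Tm Γ (just Zero) ⌜ P ⌝) → abort t ≈ u [ t ]ₛ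
  case-βl   : (t : Tm Γ Δ ⌜ P ⌝) (u : Tm Γ (just P) ⌜ S ⌝) (u' : Tm Γ (just Q) ⌜ S ⌝) →
              case (inl t) u u' ≈ u [ t ]ₛ
  case-βr   : (t : Tm Γ Δ ⌜ Q ⌝) (u : Tm Γ (just P) ⌜ S ⌝) (u' : Tm Γ (just Q) ⌜ S ⌝) →
              case (inr t) u u' ≈ u' [ t ]ₛ
  case-η    : (t : Tm Γ Δ ⌜ P ⊕ Q ⌝) (u : Tm Γ (just (P ⊕ Q)) ⌜ S ⌝) →
              case t (u [ inl stoup ]ₛ) (u [ inr stoup ]ₛ) ≈ u [ t ]ₛ
  hlam-β    : (t : Tm Γ (just P) ⌜ Q ⌝) (u : Tm Γ Δ ⌜ P ⌝) → lapp (hlam t) u ≈ t [ u ]ₛ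
  hlam-η    : (t : Tm Γ nothing (P ⊸ Q)) → hlam (lapp t stoup) ≈ t

isConst : CTy → ℕ → Bool
isConst (ccon m) n = m ≡ᵇ n
isConst _ n = false

module Translation (R : CTy) where

  _• : VTy → VTy
  _° : CTy → CTy

  vcon n • = vcon n
  one • = one
  (A ×ᵥ B) • = (A •) ×ᵥ (B •)
  (A →ᵥ B) • = (A •) →ᵥ (B •)
  ⌜ P ⌝ • = (P °) ⊸ R
  (P ⊸ Q) • = (Q °) ⊸ (P °)

  ccon n ° = if isConst R n then I else ccon n
  One ° = Zero
  (P & Q) ° = (P °) ⊕ (Q °)
  (A ⇒ Q) ° = ! (A •) ⊗ (Q °)
  I ° = R
  (! A) ° = (A •) ⇒ R
  (! A ⊗ Q) ° = (A •) ⇒ (Q °)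
  Zero ° = One
  (P ⊕ Q) ° = (P °) & (Q °)

  _•c : Ctx → Ctx
  Γ •c = map _• Γ

  varᵗ : Γ ∋ A → (Γ •c) ∋ (A •)
  varᵗ here = here
  varᵗ (there x) = there (varᵗ x)

  _•ᵗ : Tm Γ nothing A → Tm (Γ •c) nothing (A •)
  _°ᵗ : Tm Γ (just D) ⌜ P ⌝ → Tm (Γ •c) (just (P °)) ⌜ D ° ⌝

  var x •ᵗ = var (varᵗ x)
  unit •ᵗ = unit
  pair t u •ᵗ = pair (t •ᵗ) (u •ᵗ)
  fst t •ᵗ = fst (t •ᵗ)
  snd t •ᵗ = snd (t •ᵗ)
  lam t •ᵗ = lam (t •ᵗ)
  app t u •ᵗ = app (t •ᵗ) (u •ᵗ)
  cunit •ᵗ = hlam (abort stoup)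
  cpair t u •ᵗ = hlam (case stoup (lapp (t •ᵗ) stoup) (lapp (u •ᵗ) stoup))
  cfst t •ᵗ = hlam (lapp (t •ᵗ) (inl stoup))
  csnd t •ᵗ = hlam (lapp (t •ᵗ) (inr stoup))
  clam t •ᵗ = hlam (letTens stoup (lapp (t •ᵗ) stoup))
  capp s t •ᵗ = hlam (lapp (s •ᵗ) (tens (t •ᵗ) stoup))
  top •ᵗ = hlam stoup
  letTop t u •ᵗ = hlam (lapp (t •ᵗ) (lapp (u •ᵗ) stoup))
  bang t •ᵗ = hlam (capp stoup (t •ᵗ))
  letBang t u •ᵗ = hlam (lapp (t •ᵗ) (clam (lapp (u •ᵗ) stoup)))
  tens t u •ᵗ = hlam (lapp (u •ᵗ) (capp stoup (t •ᵗ)))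
  letTens s t •ᵗ = hlam (lapp (s •ᵗ) (clam (t °ᵗ)))
  abort t •ᵗ = hlam (lapp (t •ᵗ) cunit)
  inl t •ᵗ = hlam (lapp (t •ᵗ) (cfst stoup))
  inr t •ᵗ = hlam (lapp (t •ᵗ) (csnd stoup))
  case s t u •ᵗ = hlam (lapp (s •ᵗ) (cpair (t °ᵗ) (u °ᵗ)))
  hlam t •ᵗ = hlam (t °ᵗ)
  lapp s t •ᵗ = hlam (lapp (t •ᵗ) (lapp (s •ᵗ) stoup))

  stoup °ᵗ = stoup
  cunit °ᵗ = abort stoup
  cpair t u °ᵗ = case stoup (t °ᵗ) (u °ᵗ)
  cfst t °ᵗ = (t °ᵗ) [ inl stoup ]ₛ
  csnd t °ᵗ = (t °ᵗ) [ inr stoup ]ₛ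
  clam t °ᵗ = letTens stoup (t °ᵗ)
  capp s t °ᵗ = (s °ᵗ) [ tens (t •ᵗ) stoup ]ₛ
  letTop t u °ᵗ = (t °ᵗ) [ lapp (u •ᵗ) stoup ]ₛ
  letBang t u °ᵗ = (t °ᵗ) [ clam (lapp (u •ᵗ) stoup) ]ₛ
  tens t u °ᵗ = (u °ᵗ) [ capp stoup (t •ᵗ) ]ₛ
  letTens s t °ᵗ = (s °ᵗ) [ clam (t °ᵗ) ]ₛ
  abort t °ᵗ = (t °ᵗ) [ cunit ]ₛ
  inl t °ᵗ = (t °ᵗ) [ cfst stoup ]ₛ
  inr t °ᵗ = (t °ᵗ) [ csnd stoup ]ₛ
  case s t u °ᵗ = (s °ᵗ) [ cpair (t °ᵗ) (u °ᵗ) ]ₛ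
  lapp s t °ᵗ = (t °ᵗ) [ lapp (s •ᵗ) stoup ]ₛ

module Submission where

-- Under these hypotheses R ° = I and ccon m ° ° = ccon m, so translating
-- twice gives back isomorphic types: we build, by induction on types, mutually
-- inverse value maps  φ A : A → A • •  and linear stoup maps  Ψ P : P ⊸ P ° °.  The
-- key lemma says that double translation is, up to these isomorphisms, the
-- identity:  t •ᵗ •ᵗ ≈ φ A (t[Φ])  and  t °ᵗ °ᵗ ≈ Ψ Q [ t[Φ] [ Ψ⁻ P ] ],  where Φ
-- is the context isomorphism built from φ⁻.  Together with soundness of the
-- translation (t ≈ u ⇒ t •ᵗ ≈ u •ᵗ), this gives faithfulness by cancelling the
-- isomorphisms, and fullness by translating a given term back with φ⁻ / Ψ⁻.

open import Defs
open import Data.Nat using (ℕ; _≡ᵇ_)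
open import Data.Nat.Properties using (≡ᵇ⇒≡; ≡⇒≡ᵇ)
open import Data.Bool using (true; false; T)
open import Data.Unit using (tt)
open import Data.Empty using (⊥-elim)
open import Data.List using (_∷_)
open import Data.Maybe using (just; nothing)
open import Data.Product using (Σ; _×_; _,_)
open import Data.Sum using (_⊎_; inj₁; inj₂)
open import Relation.Binary.PropositionalEquality using (_≡_; refl; sym; trans; cong; cong₂; subst)

cong₃ : ∀ {a b c d} {X : Set a} {Y : Set b} {Z : Set c} {W : Set d} (f : X → Y → Z → W) {x x' y y' z z'} →
        x ≡ x' → y ≡ y' → z ≡ z' → f x y z ≡ f x' y' z'
cong₃ f refl refl refl = refl

-- Each is proved by one traversal,
-- for arbitrary maps agreeing pointwise, so that binders (extR / extS) are handled
-- by the accompanying "-ext" lemma.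

ren-ren : ∀ {Γ Γ' Γ'' Δ A} {ρ : Ren Γ Γ'} {ρ' : Ren Γ' Γ''} {ρ'' : Ren Γ Γ''} →
  (∀ {B} (x : Γ ∋ B) → ρ' (ρ x) ≡ ρ'' x) → (t : Tm Γ Δ A) → ren ρ' (ren ρ t) ≡ ren ρ'' t
ren-ren-ext : ∀ {Γ Γ' Γ'' C} {ρ : Ren Γ Γ'} {ρ' : Ren Γ' Γ''} {ρ'' : Ren Γ Γ''} →
  (∀ {B} (x : Γ ∋ B) → ρ' (ρ x) ≡ ρ'' x) → (∀ {B} (x : (C ∷ Γ) ∋ B) → extR ρ' (extR ρ x) ≡ extR ρ'' x)
ren-ren-ext e here = refl
ren-ren-ext e (there x) = cong there (e x)
ren-ren e (var x) = cong var (e x)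
ren-ren e unit = refl
ren-ren e (pair a0 a1) = cong₂ pair (ren-ren e a0) (ren-ren e a1)
ren-ren e (fst a0) = cong fst (ren-ren e a0)
ren-ren e (snd a0) = cong snd (ren-ren e a0)
ren-ren e (lam a0) = cong lam (ren-ren (ren-ren-ext e) a0)
ren-ren e (app a0 a1) = cong₂ app (ren-ren e a0) (ren-ren e a1)
ren-ren e stoup = refl
ren-ren e cunit = refl
ren-ren e (cpair a0 a1) = cong₂ cpair (ren-ren e a0) (ren-ren e a1)
ren-ren e (cfst a0) = cong cfst (ren-ren e a0)
ren-ren e (csnd a0) = cong csnd (ren-ren e a0)
ren-ren e (clam a0) = cong clam (ren-ren (ren-ren-ext e) a0)
ren-ren e (capp a0 a1) = cong₂ capp (ren-ren e a0) (ren-ren e a1)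
ren-ren e top = refl
ren-ren e (letTop a0 a1) = cong₂ letTop (ren-ren e a0) (ren-ren e a1)
ren-ren e (bang a0) = cong bang (ren-ren e a0)
ren-ren e (letBang a0 a1) = cong₂ letBang (ren-ren e a0) (ren-ren (ren-ren-ext e) a1)
ren-ren e (tens a0 a1) = cong₂ tens (ren-ren e a0) (ren-ren e a1)
ren-ren e (letTens a0 a1) = cong₂ letTens (ren-ren e a0) (ren-ren (ren-ren-ext e) a1)
ren-ren e (abort a0) = cong abort (ren-ren e a0)
ren-ren e (inl a0) = cong inl (ren-ren e a0)
ren-ren e (inr a0) = cong inr (ren-ren e a0)
ren-ren e (case a0 a1 a2) = cong₃ case (ren-ren e a0) (ren-ren e a1) (ren-ren e a2)
ren-ren e (hlam a0) = cong hlam (ren-ren e a0)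
ren-ren e (lapp a0 a1) = cong₂ lapp (ren-ren e a0) (ren-ren e a1)

ren-sub : ∀ {Γ Γ' Γ'' Δ A} {σ : Sub Γ Γ'} {ρ : Ren Γ' Γ''} {σ' : Sub Γ Γ''} →
  (∀ {B} (x : Γ ∋ B) → ren ρ (σ x) ≡ σ' x) → (t : Tm Γ Δ A) → ren ρ (sub σ t) ≡ sub σ' t
ren-sub-ext : ∀ {Γ Γ' Γ'' C} {σ : Sub Γ Γ'} {ρ : Ren Γ' Γ''} {σ' : Sub Γ Γ''} →
  (∀ {B} (x : Γ ∋ B) → ren ρ (σ x) ≡ σ' x) → (∀ {B} (x : (C ∷ Γ) ∋ B) → ren (extR ρ) (extS σ x) ≡ extS σ' x)
ren-sub-ext e here = refl
ren-sub-ext {σ = σ} e (there x) = trans (ren-ren (λ _ → refl) (σ x)) (trans (sym (ren-ren (λ _ → refl) (σ x))) (cong wk (e x)))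
ren-sub e (var x) = e x
ren-sub e unit = refl
ren-sub e (pair a0 a1) = cong₂ pair (ren-sub e a0) (ren-sub e a1)
ren-sub e (fst a0) = cong fst (ren-sub e a0)
ren-sub e (snd a0) = cong snd (ren-sub e a0)
ren-sub e (lam a0) = cong lam (ren-sub (ren-sub-ext e) a0)
ren-sub e (app a0 a1) = cong₂ app (ren-sub e a0) (ren-sub e a1)
ren-sub e stoup = refl
ren-sub e cunit = refl
ren-sub e (cpair a0 a1) = cong₂ cpair (ren-sub e a0) (ren-sub e a1)
ren-sub e (cfst a0) = cong cfst (ren-sub e a0)
ren-sub e (csnd a0) = cong csnd (ren-sub e a0)
ren-sub e (clam a0) = cong clam (ren-sub (ren-sub-ext e) a0)
ren-sub e (capp a0 a1) = cong₂ capp (ren-sub e a0) (ren-sub e a1)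
ren-sub e top = refl
ren-sub e (letTop a0 a1) = cong₂ letTop (ren-sub e a0) (ren-sub e a1)
ren-sub e (bang a0) = cong bang (ren-sub e a0)
ren-sub e (letBang a0 a1) = cong₂ letBang (ren-sub e a0) (ren-sub (ren-sub-ext e) a1)
ren-sub e (tens a0 a1) = cong₂ tens (ren-sub e a0) (ren-sub e a1)
ren-sub e (letTens a0 a1) = cong₂ letTens (ren-sub e a0) (ren-sub (ren-sub-ext e) a1)
ren-sub e (abort a0) = cong abort (ren-sub e a0)
ren-sub e (inl a0) = cong inl (ren-sub e a0)
ren-sub e (inr a0) = cong inr (ren-sub e a0)
ren-sub e (case a0 a1 a2) = cong₃ case (ren-sub e a0) (ren-sub e a1) (ren-sub e a2)
ren-sub e (hlam a0) = cong hlam (ren-sub e a0)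
ren-sub e (lapp a0 a1) = cong₂ lapp (ren-sub e a0) (ren-sub e a1)

sub-ren : ∀ {Γ Γ' Γ'' Δ A} {ρ : Ren Γ Γ'} {σ : Sub Γ' Γ''} {σ' : Sub Γ Γ''} →
  (∀ {B} (x : Γ ∋ B) → σ (ρ x) ≡ σ' x) → (t : Tm Γ Δ A) → sub σ (ren ρ t) ≡ sub σ' t
sub-ren-ext : ∀ {Γ Γ' Γ'' C} {ρ : Ren Γ Γ'} {σ : Sub Γ' Γ''} {σ' : Sub Γ Γ''} →
  (∀ {B} (x : Γ ∋ B) → σ (ρ x) ≡ σ' x) → (∀ {B} (x : (C ∷ Γ) ∋ B) → extS σ (extR ρ x) ≡ extS σ' x)
sub-ren-ext e here = refl
sub-ren-ext e (there x) = cong wk (e x)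
sub-ren e (var x) = e x
sub-ren e unit = refl
sub-ren e (pair a0 a1) = cong₂ pair (sub-ren e a0) (sub-ren e a1)
sub-ren e (fst a0) = cong fst (sub-ren e a0)
sub-ren e (snd a0) = cong snd (sub-ren e a0)
sub-ren e (lam a0) = cong lam (sub-ren (sub-ren-ext e) a0)
sub-ren e (app a0 a1) = cong₂ app (sub-ren e a0) (sub-ren e a1)
sub-ren e stoup = refl
sub-ren e cunit = refl
sub-ren e (cpair a0 a1) = cong₂ cpair (sub-ren e a0) (sub-ren e a1)
sub-ren e (cfst a0) = cong cfst (sub-ren e a0)
sub-ren e (csnd a0) = cong csnd (sub-ren e a0)
sub-ren e (clam a0) = cong clam (sub-ren (sub-ren-ext e) a0)
sub-ren e (capp a0 a1) = cong₂ capp (sub-ren e a0) (sub-ren e a1)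
sub-ren e top = refl
sub-ren e (letTop a0 a1) = cong₂ letTop (sub-ren e a0) (sub-ren e a1)
sub-ren e (bang a0) = cong bang (sub-ren e a0)
sub-ren e (letBang a0 a1) = cong₂ letBang (sub-ren e a0) (sub-ren (sub-ren-ext e) a1)
sub-ren e (tens a0 a1) = cong₂ tens (sub-ren e a0) (sub-ren e a1)
sub-ren e (letTens a0 a1) = cong₂ letTens (sub-ren e a0) (sub-ren (sub-ren-ext e) a1)
sub-ren e (abort a0) = cong abort (sub-ren e a0)
sub-ren e (inl a0) = cong inl (sub-ren e a0)
sub-ren e (inr a0) = cong inr (sub-ren e a0)
sub-ren e (case a0 a1 a2) = cong₃ case (sub-ren e a0) (sub-ren e a1) (sub-ren e a2)
sub-ren e (hlam a0) = cong hlam (sub-ren e a0)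
sub-ren e (lapp a0 a1) = cong₂ lapp (sub-ren e a0) (sub-ren e a1)

sub-sub : ∀ {Γ Γ' Γ'' Δ A} {σ : Sub Γ Γ'} {σ' : Sub Γ' Γ''} {σ'' : Sub Γ Γ''} →
  (∀ {B} (x : Γ ∋ B) → sub σ' (σ x) ≡ σ'' x) → (t : Tm Γ Δ A) → sub σ' (sub σ t) ≡ sub σ'' t
sub-sub-ext : ∀ {Γ Γ' Γ'' C} {σ : Sub Γ Γ'} {σ' : Sub Γ' Γ''} {σ'' : Sub Γ Γ''} →
  (∀ {B} (x : Γ ∋ B) → sub σ' (σ x) ≡ σ'' x) → (∀ {B} (x : (C ∷ Γ) ∋ B) → sub (extS σ') (extS σ x) ≡ extS σ'' x)
sub-sub-ext e here = refl
sub-sub-ext {σ = σ} e (there x) = trans (sub-ren (λ _ → refl) (σ x)) (trans (sym (ren-sub (λ _ → refl) (σ x))) (cong wk (e x)))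
sub-sub e (var x) = e x
sub-sub e unit = refl
sub-sub e (pair a0 a1) = cong₂ pair (sub-sub e a0) (sub-sub e a1)
sub-sub e (fst a0) = cong fst (sub-sub e a0)
sub-sub e (snd a0) = cong snd (sub-sub e a0)
sub-sub e (lam a0) = cong lam (sub-sub (sub-sub-ext e) a0)
sub-sub e (app a0 a1) = cong₂ app (sub-sub e a0) (sub-sub e a1)
sub-sub e stoup = refl
sub-sub e cunit = refl
sub-sub e (cpair a0 a1) = cong₂ cpair (sub-sub e a0) (sub-sub e a1)
sub-sub e (cfst a0) = cong cfst (sub-sub e a0)
sub-sub e (csnd a0) = cong csnd (sub-sub e a0)
sub-sub e (clam a0) = cong clam (sub-sub (sub-sub-ext e) a0)
sub-sub e (capp a0 a1) = cong₂ capp (sub-sub e a0) (sub-sub e a1)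
sub-sub e top = refl
sub-sub e (letTop a0 a1) = cong₂ letTop (sub-sub e a0) (sub-sub e a1)
sub-sub e (bang a0) = cong bang (sub-sub e a0)
sub-sub e (letBang a0 a1) = cong₂ letBang (sub-sub e a0) (sub-sub (sub-sub-ext e) a1)
sub-sub e (tens a0 a1) = cong₂ tens (sub-sub e a0) (sub-sub e a1)
sub-sub e (letTens a0 a1) = cong₂ letTens (sub-sub e a0) (sub-sub (sub-sub-ext e) a1)
sub-sub e (abort a0) = cong abort (sub-sub e a0)
sub-sub e (inl a0) = cong inl (sub-sub e a0)
sub-sub e (inr a0) = cong inr (sub-sub e a0)
sub-sub e (case a0 a1 a2) = cong₃ case (sub-sub e a0) (sub-sub e a1) (sub-sub e a2)
sub-sub e (hlam a0) = cong hlam (sub-sub e a0)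
sub-sub e (lapp a0 a1) = cong₂ lapp (sub-sub e a0) (sub-sub e a1)

sub-id : ∀ {Γ Δ A} {σ : Sub Γ Γ} →
  (∀ {B} (x : Γ ∋ B) → σ x ≡ var x) → (t : Tm Γ Δ A) → sub σ t ≡ t
sub-id-ext : ∀ {Γ C} {σ : Sub Γ Γ} →
  (∀ {B} (x : Γ ∋ B) → σ x ≡ var x) → (∀ {B} (x : (C ∷ Γ) ∋ B) → extS σ x ≡ var x)
sub-id-ext e here = refl
sub-id-ext e (there x) = cong wk (e x)
sub-id e (var x) = e x
sub-id e unit = refl
sub-id e (pair a0 a1) = cong₂ pair (sub-id e a0) (sub-id e a1)
sub-id e (fst a0) = cong fst (sub-id e a0)
sub-id e (snd a0) = cong snd (sub-id e a0)
sub-id e (lam a0) = cong lam (sub-id (sub-id-ext e) a0)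
sub-id e (app a0 a1) = cong₂ app (sub-id e a0) (sub-id e a1)
sub-id e stoup = refl
sub-id e cunit = refl
sub-id e (cpair a0 a1) = cong₂ cpair (sub-id e a0) (sub-id e a1)
sub-id e (cfst a0) = cong cfst (sub-id e a0)
sub-id e (csnd a0) = cong csnd (sub-id e a0)
sub-id e (clam a0) = cong clam (sub-id (sub-id-ext e) a0)
sub-id e (capp a0 a1) = cong₂ capp (sub-id e a0) (sub-id e a1)
sub-id e top = refl
sub-id e (letTop a0 a1) = cong₂ letTop (sub-id e a0) (sub-id e a1)
sub-id e (bang a0) = cong bang (sub-id e a0)
sub-id e (letBang a0 a1) = cong₂ letBang (sub-id e a0) (sub-id (sub-id-ext e) a1)
sub-id e (tens a0 a1) = cong₂ tens (sub-id e a0) (sub-id e a1)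
sub-id e (letTens a0 a1) = cong₂ letTens (sub-id e a0) (sub-id (sub-id-ext e) a1)
sub-id e (abort a0) = cong abort (sub-id e a0)
sub-id e (inl a0) = cong inl (sub-id e a0)
sub-id e (inr a0) = cong inr (sub-id e a0)
sub-id e (case a0 a1 a2) = cong₃ case (sub-id e a0) (sub-id e a1) (sub-id e a2)
sub-id e (hlam a0) = cong hlam (sub-id e a0)
sub-id e (lapp a0 a1) = cong₂ lapp (sub-id e a0) (sub-id e a1)

wk-ren : ∀ {Γ Γ' Δ A B} (ρ : Ren Γ Γ') (t : Tm Γ Δ A) → ren (extR {A = B} ρ) (wk t) ≡ wk (ren ρ t)
wk-ren ρ t = trans (ren-ren (λ _ → refl) t) (sym (ren-ren (λ _ → refl) t))

wk-sub : ∀ {Γ Γ' Δ A B} (σ : Sub Γ Γ') (t : Tm Γ Δ A) → sub (extS {A = B} σ) (wk t) ≡ wk (sub σ t)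
wk-sub σ t = trans (sub-ren (λ _ → refl) t) (sym (ren-sub (λ _ → refl) t))

ren-st : ∀ {Γ Γ' Δ D A} (ρ : Ren Γ Γ') (t : Tm Γ (just D) A) (s : Tm Γ Δ ⌜ D ⌝) → ren ρ (t [ s ]ₛ) ≡ (ren ρ t) [ ren ρ s ]ₛ
ren-st ρ stoup s = refl
ren-st ρ cunit s = refl
ren-st ρ (cpair t u) s = cong₂ cpair (ren-st ρ t s) (ren-st ρ u s)
ren-st ρ (cfst t) s = cong cfst (ren-st ρ t s)
ren-st ρ (csnd t) s = cong csnd (ren-st ρ t s)
ren-st ρ (clam t) s = cong clam (trans (ren-st (extR ρ) t (wk s)) (cong (ren (extR ρ) t [_]ₛ) (wk-ren ρ s)))
ren-st ρ (capp t u) s = cong (λ x → capp x (ren ρ u)) (ren-st ρ t s)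
ren-st ρ (letTop t u) s = cong (λ x → letTop x (ren ρ u)) (ren-st ρ t s)
ren-st ρ (letBang t u) s = cong (λ x → letBang x (ren (extR ρ) u)) (ren-st ρ t s)
ren-st ρ (tens t u) s = cong (tens (ren ρ t)) (ren-st ρ u s)
ren-st ρ (letTens t u) s = cong (λ x → letTens x (ren (extR ρ) u)) (ren-st ρ t s)
ren-st ρ (abort t) s = cong abort (ren-st ρ t s)
ren-st ρ (inl t) s = cong inl (ren-st ρ t s)
ren-st ρ (inr t) s = cong inr (ren-st ρ t s)
ren-st ρ (case r t u) s = cong (λ x → case x (ren ρ t) (ren ρ u)) (ren-st ρ r s)
ren-st ρ (lapp t u) s = cong (lapp (ren ρ t)) (ren-st ρ u s)

sub-st : ∀ {Γ Γ' Δ D A} (σ : Sub Γ Γ') (t : Tm Γ (just D) A) (s : Tm Γ Δ ⌜ D ⌝) → sub σ (t [ s ]ₛ) ≡ (sub σ t) [ sub σ s ]ₛ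
sub-st σ stoup s = refl
sub-st σ cunit s = refl
sub-st σ (cpair t u) s = cong₂ cpair (sub-st σ t s) (sub-st σ u s)
sub-st σ (cfst t) s = cong cfst (sub-st σ t s)
sub-st σ (csnd t) s = cong csnd (sub-st σ t s)
sub-st σ (clam t) s = cong clam (trans (sub-st (extS σ) t (wk s)) (cong (sub (extS σ) t [_]ₛ) (wk-sub σ s)))
sub-st σ (capp t u) s = cong (λ x → capp x (sub σ u)) (sub-st σ t s)
sub-st σ (letTop t u) s = cong (λ x → letTop x (sub σ u)) (sub-st σ t s)
sub-st σ (letBang t u) s = cong (λ x → letBang x (sub (extS σ) u)) (sub-st σ t s)
sub-st σ (tens t u) s = cong (tens (sub σ t)) (sub-st σ u s)
sub-st σ (letTens t u) s = cong (λ x → letTens x (sub (extS σ) u)) (sub-st σ t s)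
sub-st σ (abort t) s = cong abort (sub-st σ t s)
sub-st σ (inl t) s = cong inl (sub-st σ t s)
sub-st σ (inr t) s = cong inr (sub-st σ t s)
sub-st σ (case r t u) s = cong (λ x → case x (sub σ t) (sub σ u)) (sub-st σ r s)
sub-st σ (lapp t u) s = cong (lapp (sub σ t)) (sub-st σ u s)

sub-st-with : ∀ {Γ Γ' Δ D A} {σ : Sub Γ Γ'} (X : Tm Γ (just D) A) {X' : Tm Γ' (just D) A} (Y : Tm Γ Δ ⌜ D ⌝) →
    sub σ X ≡ X' → sub σ (X [ Y ]ₛ) ≡ X' [ sub σ Y ]ₛ
sub-st-with {σ = σ} X Y p = trans (sub-st σ X Y) (cong (_[ sub σ Y ]ₛ) p)

st-assoc : ∀ {Γ Δ D E A} (t : Tm Γ (just D) A) (s : Tm Γ (just E) ⌜ D ⌝) (r : Tm Γ Δ ⌜ E ⌝) → (t [ s ]ₛ) [ r ]ₛ ≡ t [ s [ r ]ₛ ]ₛ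
st-assoc stoup s r = refl
st-assoc cunit s r = refl
st-assoc (cpair t u) s r = cong₂ cpair (st-assoc t s r) (st-assoc u s r)
st-assoc (cfst t) s r = cong cfst (st-assoc t s r)
st-assoc (csnd t) s r = cong csnd (st-assoc t s r)
st-assoc (clam t) s r = cong clam (trans (st-assoc t (wk s) (wk r)) (cong (t [_]ₛ) (sym (ren-st there s r))))
st-assoc (capp t u) s r = cong (λ x → capp x u) (st-assoc t s r)
st-assoc (letTop t u) s r = cong (λ x → letTop x u) (st-assoc t s r)
st-assoc (letBang t u) s r = cong (λ x → letBang x u) (st-assoc t s r)
st-assoc (tens t u) s r = cong (tens t) (st-assoc u s r)
st-assoc (letTens t u) s r = cong (λ x → letTens x u) (st-assoc t s r)
st-assoc (abort t) s r = cong abort (st-assoc t s r)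
st-assoc (inl t) s r = cong inl (st-assoc t s r)
st-assoc (inr t) s r = cong inr (st-assoc t s r)
st-assoc (case q t u) s r = cong (λ x → case x t u) (st-assoc q s r)
st-assoc (lapp t u) s r = cong (lapp t) (st-assoc u s r)

st-id : ∀ {Γ D A} (t : Tm Γ (just D) A) → t [ stoup ]ₛ ≡ t
st-id stoup = refl
st-id cunit = refl
st-id (cpair t u) = cong₂ cpair (st-id t) (st-id u)
st-id (cfst t) = cong cfst (st-id t)
st-id (csnd t) = cong csnd (st-id t)
st-id (clam t) = cong clam (st-id t)
st-id (capp t u) = cong (λ x → capp x u) (st-id t)
st-id (letTop t u) = cong (λ x → letTop x u) (st-id t)
st-id (letBang t u) = cong (λ x → letBang x u) (st-id t)
st-id (tens t u) = cong (tens t) (st-id u)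
st-id (letTens t u) = cong (λ x → letTens x u) (st-id t)
st-id (abort t) = cong abort (st-id t)
st-id (inl t) = cong inl (st-id t)
st-id (inr t) = cong inr (st-id t)
st-id (case q t u) = cong (λ x → case x t u) (st-id q)
st-id (lapp t u) = cong (lapp t) (st-id u)

wk-single : ∀ {Γ Δ A B} (t : Tm Γ Δ A) (u : Tm Γ nothing B) → sub (single u) (wk t) ≡ t
wk-single t u = trans (sub-ren (λ _ → refl) t) (sub-id (λ _ → refl) t)

sub-single : ∀ {Γ Γ' Δ A B} (σ : Sub Γ Γ') (t : Tm (B ∷ Γ) Δ A) (u : Tm Γ nothing B) → sub σ (t [ u ]) ≡ (sub (extS σ) t) [ sub σ u ]
sub-single σ t u = trans (sub-sub f t) (sym (sub-sub (λ _ → refl) t))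
  where
  f : ∀ {C} (x : _ ∋ C) → sub σ (single u x) ≡ sub (single (sub σ u)) (extS σ x)
  f here = refl
  f (there x) = sym (wk-single (σ x) _)

ren-as-sub : ∀ {Γ Γ' Δ A} (ρ : Ren Γ Γ') (t : Tm Γ Δ A) → ren ρ t ≡ sub (λ x → var (ρ x)) t
ren-as-sub ρ t = trans (sym (sub-id (λ _ → refl) (ren ρ t))) (sub-ren (λ _ → refl) t)

ext-var : ∀ {Γ Δ A B} (t : Tm (B ∷ Γ) Δ A) → sub (single (var here)) (ren (extR there) t) ≡ t
ext-var t = trans (sub-ren f t) (sub-id (λ _ → refl) t)
  where
  f : ∀ {C} (x : _ ∋ C) → single (var here) (extR there x) ≡ var x
  f here = refl
  f (there x) = refl

cast≈ : ∀ {Γ Δ A} {a a' b b' : Tm Γ Δ A} → a ≡ a' → b ≡ b' → a ≈ b → a' ≈ b'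
cast≈ refl refl p = p

≡→≈ : ∀ {Γ Δ A} {a b : Tm Γ Δ A} → a ≡ b → a ≈ b
≡→≈ refl = ≈-refl

≈-sub : ∀ {Γ Γ' Δ A} (σ : Sub Γ Γ') {t u : Tm Γ Δ A} → t ≈ u → sub σ t ≈ sub σ u
≈-sub σ ≈-refl = ≈-refl
≈-sub σ (≈-sym p) = ≈-sym (≈-sub σ p)
≈-sub σ (≈-trans p q) = ≈-trans (≈-sub σ p) (≈-sub σ q)
≈-sub σ (pair-cong p q) = pair-cong (≈-sub σ p) (≈-sub σ q)
≈-sub σ (fst-cong p) = fst-cong (≈-sub σ p)
≈-sub σ (snd-cong p) = snd-cong (≈-sub σ p)
≈-sub σ (lam-cong p) = lam-cong (≈-sub (extS σ) p)
≈-sub σ (app-cong p q) = app-cong (≈-sub σ p) (≈-sub σ q)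
≈-sub σ (cpair-cong p q) = cpair-cong (≈-sub σ p) (≈-sub σ q)
≈-sub σ (cfst-cong p) = cfst-cong (≈-sub σ p)
≈-sub σ (csnd-cong p) = csnd-cong (≈-sub σ p)
≈-sub σ (clam-cong p) = clam-cong (≈-sub (extS σ) p)
≈-sub σ (capp-cong p q) = capp-cong (≈-sub σ p) (≈-sub σ q)
≈-sub σ (letTop-cong p q) = letTop-cong (≈-sub σ p) (≈-sub σ q)
≈-sub σ (bang-cong p) = bang-cong (≈-sub σ p)
≈-sub σ (letBang-cong p q) = letBang-cong (≈-sub σ p) (≈-sub (extS σ) q)
≈-sub σ (tens-cong p q) = tens-cong (≈-sub σ p) (≈-sub σ q)
≈-sub σ (letTens-cong p q) = letTens-cong (≈-sub σ p) (≈-sub (extS σ) q)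
≈-sub σ (abort-cong p) = abort-cong (≈-sub σ p)
≈-sub σ (inl-cong p) = inl-cong (≈-sub σ p)
≈-sub σ (inr-cong p) = inr-cong (≈-sub σ p)
≈-sub σ (case-cong p q r) = case-cong (≈-sub σ p) (≈-sub σ q) (≈-sub σ r)
≈-sub σ (hlam-cong p) = hlam-cong (≈-sub σ p)
≈-sub σ (lapp-cong p q) = lapp-cong (≈-sub σ p) (≈-sub σ q)
≈-sub σ (one-η t) = one-η _
≈-sub σ (fst-β t u) = fst-β _ _
≈-sub σ (snd-β t u) = snd-β _ _
≈-sub σ (pair-η t) = pair-η _
≈-sub σ (lam-β t u) = cast≈ refl (sym (sub-single σ t u)) (lam-β _ _)
≈-sub σ (lam-η t) = cast≈ (cong (λ x → lam (app x (var here))) (sym (wk-sub σ t))) refl (lam-η _)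
≈-sub σ (One-η t) = One-η _
≈-sub σ (cfst-β t u) = cfst-β _ _
≈-sub σ (csnd-β t u) = csnd-β _ _
≈-sub σ (cpair-η t) = cpair-η _
≈-sub σ (clam-β t u) = cast≈ refl (sym (sub-single σ t u)) (clam-β _ _)
≈-sub σ (clam-η t) = cast≈ (cong (λ x → clam (capp x (var here))) (sym (wk-sub σ t))) refl (clam-η _)
≈-sub σ (letTop-β t) = letTop-β _
≈-sub σ (letTop-η t u) = cast≈ (cong (letTop (sub σ t)) (sym (sub-st σ u top))) (sym (sub-st σ u t)) (letTop-η (sub σ t) (sub σ u))
≈-sub σ (letBang-β t u) = cast≈ refl (sym (sub-single σ u t)) (letBang-β _ _)
≈-sub σ (letBang-η t u) = cast≈
    (cong (letBang (sub σ t)) (trans (cong (_[ bang (var here) ]ₛ) (sym (wk-sub σ u))) (sym (sub-st (extS σ) (wk u) (bang (var here)))))) (sym (sub-st σ u t)) (letBang-η (sub σ t) (sub σ u))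
≈-sub σ (letTens-β t s u) = cast≈ refl (trans (cong (_[ sub σ s ]ₛ) (sym (sub-single σ u t))) (sym (sub-st σ (u [ t ]) s)))
    (letTens-β _ _ _)
≈-sub σ (letTens-η t u) = cast≈
    (cong (letTens (sub σ t)) (trans (cong (_[ tens (var here) stoup ]ₛ) (sym (wk-sub σ u))) (sym (sub-st (extS σ) (wk u) (tens (var here) stoup))))) (sym (sub-st σ u t)) (letTens-η (sub σ t) (sub σ u))
≈-sub σ (abort-η t u) = cast≈ refl (sym (sub-st σ u t)) (abort-η _ _)
≈-sub σ (case-βl t u u') = cast≈ refl (sym (sub-st σ u t)) (case-βl _ _ _)
≈-sub σ (case-βr t u u') = cast≈ refl (sym (sub-st σ u' t)) (case-βr _ _ _)
≈-sub σ (case-η t u) = cast≈ (cong₂ (case (sub σ t)) (sym (sub-st σ u (inl stoup))) (sym (sub-st σ u (inr stoup))))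
    (sym (sub-st σ u t)) (case-η (sub σ t) (sub σ u))
≈-sub σ (hlam-β t u) = cast≈ refl (sym (sub-st σ t u)) (hlam-β _ _)
≈-sub σ (hlam-η t) = hlam-η _

≈-ren : ∀ {Γ Γ' Δ A} (ρ : Ren Γ Γ') {t u : Tm Γ Δ A} → t ≈ u → ren ρ t ≈ ren ρ u
≈-ren ρ {t} {u} p = cast≈ (sym (ren-as-sub ρ t)) (sym (ren-as-sub ρ u)) (≈-sub _ p)

≈-wk : ∀ {Γ Δ A B} {t u : Tm Γ Δ A} → t ≈ u → wk {B = B} t ≈ wk u
≈-wk = ≈-ren there

sub-≈ : ∀ {Γ Γ' Δ A} {σ σ' : Sub Γ Γ'} → (∀ {B} (x : Γ ∋ B) → σ x ≈ σ' x) → (t : Tm Γ Δ A) → sub σ t ≈ sub σ' t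
sub-≈-ext : ∀ {Γ Γ' C} {σ σ' : Sub Γ Γ'} → (∀ {B} (x : Γ ∋ B) → σ x ≈ σ' x) → (∀ {B} (x : (C ∷ Γ) ∋ B) → extS σ x ≈ extS σ' x)
sub-≈-ext e here = ≈-refl
sub-≈-ext e (there x) = ≈-wk (e x)
sub-≈ e (var x) = e x
sub-≈ e unit = ≈-refl
sub-≈ e (pair a0 a1) = pair-cong (sub-≈ e a0) (sub-≈ e a1)
sub-≈ e (fst a0) = fst-cong (sub-≈ e a0)
sub-≈ e (snd a0) = snd-cong (sub-≈ e a0)
sub-≈ e (lam a0) = lam-cong (sub-≈ (sub-≈-ext e) a0)
sub-≈ e (app a0 a1) = app-cong (sub-≈ e a0) (sub-≈ e a1)
sub-≈ e stoup = ≈-refl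
sub-≈ e cunit = ≈-refl
sub-≈ e (cpair a0 a1) = cpair-cong (sub-≈ e a0) (sub-≈ e a1)
sub-≈ e (cfst a0) = cfst-cong (sub-≈ e a0)
sub-≈ e (csnd a0) = csnd-cong (sub-≈ e a0)
sub-≈ e (clam a0) = clam-cong (sub-≈ (sub-≈-ext e) a0)
sub-≈ e (capp a0 a1) = capp-cong (sub-≈ e a0) (sub-≈ e a1)
sub-≈ e top = ≈-refl
sub-≈ e (letTop a0 a1) = letTop-cong (sub-≈ e a0) (sub-≈ e a1)
sub-≈ e (bang a0) = bang-cong (sub-≈ e a0)
sub-≈ e (letBang a0 a1) = letBang-cong (sub-≈ e a0) (sub-≈ (sub-≈-ext e) a1)
sub-≈ e (tens a0 a1) = tens-cong (sub-≈ e a0) (sub-≈ e a1)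
sub-≈ e (letTens a0 a1) = letTens-cong (sub-≈ e a0) (sub-≈ (sub-≈-ext e) a1)
sub-≈ e (abort a0) = abort-cong (sub-≈ e a0)
sub-≈ e (inl a0) = inl-cong (sub-≈ e a0)
sub-≈ e (inr a0) = inr-cong (sub-≈ e a0)
sub-≈ e (case a0 a1 a2) = case-cong (sub-≈ e a0) (sub-≈ e a1) (sub-≈ e a2)
sub-≈ e (hlam a0) = hlam-cong (sub-≈ e a0)
sub-≈ e (lapp a0 a1) = lapp-cong (sub-≈ e a0) (sub-≈ e a1)

≈-st-r : ∀ {Γ Δ D A} (t : Tm Γ (just D) A) {s s' : Tm Γ Δ ⌜ D ⌝} → s ≈ s' → t [ s ]ₛ ≈ t [ s' ]ₛ
≈-st-r stoup p = p
≈-st-r cunit p = ≈-refl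
≈-st-r (cpair t u) p = cpair-cong (≈-st-r t p) (≈-st-r u p)
≈-st-r (cfst t) p = cfst-cong (≈-st-r t p)
≈-st-r (csnd t) p = csnd-cong (≈-st-r t p)
≈-st-r (clam t) p = clam-cong (≈-st-r t (≈-wk p))
≈-st-r (capp t u) p = capp-cong (≈-st-r t p) ≈-refl
≈-st-r (letTop t u) p = letTop-cong (≈-st-r t p) ≈-refl
≈-st-r (letBang t u) p = letBang-cong (≈-st-r t p) ≈-refl
≈-st-r (tens t u) p = tens-cong ≈-refl (≈-st-r u p)
≈-st-r (letTens t u) p = letTens-cong (≈-st-r t p) ≈-refl
≈-st-r (abort t) p = abort-cong (≈-st-r t p)
≈-st-r (inl t) p = inl-cong (≈-st-r t p)
≈-st-r (inr t) p = inr-cong (≈-st-r t p)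
≈-st-r (case q t u) p = case-cong (≈-st-r q p) ≈-refl ≈-refl
≈-st-r (lapp t u) p = lapp-cong ≈-refl (≈-st-r u p)

clam-β-st : ∀ {Γ Δ D A B} (t : Tm (A ∷ Γ) (just D) B) (s : Tm Γ Δ ⌜ D ⌝) (u : Tm Γ nothing A) →
    sub (single u) (t [ wk s ]ₛ) ≡ (t [ u ]) [ s ]ₛ
clam-β-st t s u = trans (sub-st (single u) t (wk s)) (cong ((t [ u ]) [_]ₛ) (wk-single s u))

≈-st-l : ∀ {Γ Δ D A} {t t' : Tm Γ (just D) A} → t ≈ t' → (s : Tm Γ Δ ⌜ D ⌝) → t [ s ]ₛ ≈ t' [ s ]ₛ
≈-st-l ≈-refl s = ≈-refl
≈-st-l (≈-sym p) s = ≈-sym (≈-st-l p s)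
≈-st-l (≈-trans p q) s = ≈-trans (≈-st-l p s) (≈-st-l q s)
≈-st-l (cpair-cong p q) s = cpair-cong (≈-st-l p s) (≈-st-l q s)
≈-st-l (cfst-cong p) s = cfst-cong (≈-st-l p s)
≈-st-l (csnd-cong p) s = csnd-cong (≈-st-l p s)
≈-st-l (clam-cong p) s = clam-cong (≈-st-l p (wk s))
≈-st-l (capp-cong p q) s = capp-cong (≈-st-l p s) q
≈-st-l (letTop-cong p q) s = letTop-cong (≈-st-l p s) q
≈-st-l (letBang-cong p q) s = letBang-cong (≈-st-l p s) q
≈-st-l (tens-cong p q) s = tens-cong p (≈-st-l q s)
≈-st-l (letTens-cong p q) s = letTens-cong (≈-st-l p s) q
≈-st-l (abort-cong p) s = abort-cong (≈-st-l p s)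
≈-st-l (inl-cong p) s = inl-cong (≈-st-l p s)
≈-st-l (inr-cong p) s = inr-cong (≈-st-l p s)
≈-st-l (case-cong p q r) s = case-cong (≈-st-l p s) q r
≈-st-l (lapp-cong p q) s = lapp-cong p (≈-st-l q s)
≈-st-l (One-η t) s = One-η _
≈-st-l (cfst-β t u) s = cfst-β _ _
≈-st-l (csnd-β t u) s = csnd-β _ _
≈-st-l (cpair-η t) s = cpair-η _
≈-st-l (clam-β t u) s = cast≈ refl (clam-β-st t s u) (clam-β _ _)
≈-st-l (clam-η t) s = cast≈ (cong (λ x → clam (capp x (var here))) (ren-st there t s)) refl (clam-η _)
≈-st-l (letTop-η t u) s = cast≈ refl (sym (st-assoc u t s)) (letTop-η _ _)
≈-st-l (letBang-η t u) s = cast≈ refl (sym (st-assoc u t s)) (letBang-η _ _)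
≈-st-l (letTens-β t s' u) s = cast≈ refl (sym (st-assoc (u [ t ]) s' s)) (letTens-β _ _ _)
≈-st-l (letTens-η t u) s = cast≈ refl (sym (st-assoc u t s)) (letTens-η _ _)
≈-st-l (abort-η t u) s = cast≈ refl (sym (st-assoc u t s)) (abort-η _ u)
≈-st-l (case-βl t u u') s = cast≈ refl (sym (st-assoc u t s)) (case-βl _ _ _)
≈-st-l (case-βr t u u') s = cast≈ refl (sym (st-assoc u' t s)) (case-βr _ _ _)
≈-st-l (case-η t u) s = cast≈ refl (sym (st-assoc u t s)) (case-η _ _)
≈-st-l (hlam-β t u) s = cast≈ refl (sym (st-assoc t u s)) (hlam-β _ _)

≈-st : ∀ {Γ Δ D A} {t t' : Tm Γ (just D) A} {s s' : Tm Γ Δ ⌜ D ⌝} → t ≈ t' → s ≈ s' → t [ s ]ₛ ≈ t' [ s' ]ₛ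
≈-st {t' = t'} p q = ≈-trans (≈-st-l p _) (≈-st-r t' q)

st-push : ∀ {Γ Δ D E A} {x : Tm Γ (just E) A} (t : Tm Γ (just D) A) (s : Tm Γ (just E) ⌜ D ⌝) (r : Tm Γ Δ ⌜ E ⌝) →
          x ≈ t [ s ]ₛ → x [ r ]ₛ ≈ t [ s [ r ]ₛ ]ₛ
st-push t s r p = ≈-trans (≈-st-l p r) (≡→≈ (st-assoc t s r))

-- Commuting conversions: a linear context u [ - ]ₛ commutes with the eliminators
-- of the positive connectives 0, ⊕, I, !, !⊗.  Each is an instance of the
-- corresponding η-law.
CC-abort : ∀ {Γ Δ E S} (u : Tm Γ (just E) ⌜ S ⌝) (w : Tm Γ Δ ⌜ Zero ⌝) → u [ abort w ]ₛ ≈ abort w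
CC-abort u w = ≈-sym (cast≈ refl (st-assoc u (abort stoup) w) (abort-η w (u [ abort stoup ]ₛ)))

CC-case : ∀ {Γ Δ E S P Q} (u : Tm Γ (just E) ⌜ S ⌝) (w : Tm Γ Δ ⌜ P ⊕ Q ⌝) (a : Tm Γ (just P) ⌜ E ⌝) (b : Tm Γ (just Q) ⌜ E ⌝) →
  u [ case w a b ]ₛ ≈ case w (u [ a ]ₛ) (u [ b ]ₛ)
CC-case u w a b = ≈-sym (≈-trans (case-cong ≈-refl
    (≈-sym (cast≈ (sym (st-assoc u (case stoup a b) (inl stoup))) refl (≈-st-r u (≈-trans (case-βl stoup a b) (≡→≈ (st-id a))))))
    (≈-sym (cast≈ (sym (st-assoc u (case stoup a b) (inr stoup))) refl (≈-st-r u (≈-trans (case-βr stoup a b) (≡→≈ (st-id b)))))))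
  (cast≈ refl (st-assoc u (case stoup a b) w) (case-η w (u [ case stoup a b ]ₛ))))

CC-letTop : ∀ {Γ Δ E S} (u : Tm Γ (just E) ⌜ S ⌝) (w : Tm Γ Δ ⌜ I ⌝) (a : Tm Γ nothing ⌜ E ⌝) →
  u [ letTop w a ]ₛ ≈ letTop w (u [ a ]ₛ)
CC-letTop u w a = ≈-sym (≈-trans (letTop-cong ≈-refl
    (≈-sym (cast≈ (sym (st-assoc u (letTop stoup a) top)) refl (≈-st-r u (letTop-β a)))))
  (cast≈ refl (st-assoc u (letTop stoup a) w) (letTop-η w (u [ letTop stoup a ]ₛ))))

CC-letTens : ∀ {Γ Δ E S B Q} (u : Tm Γ (just E) ⌜ S ⌝) (w : Tm Γ Δ ⌜ ! B ⊗ Q ⌝) (a : Tm (B ∷ Γ) (just Q) ⌜ E ⌝) →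
  u [ letTens w a ]ₛ ≈ letTens w (wk u [ a ]ₛ)
CC-letTens u w a = ≈-sym (≈-trans (letTens-cong ≈-refl
    (≈-sym (cast≈ (cong (_[ tens (var here) stoup ]ₛ) (sym (ren-st there u (letTens stoup a))))
                  refl
      (cast≈ (sym (st-assoc (wk u) (letTens stoup (ren (extR there) a)) (tens (var here) stoup))) refl
        (≈-st-r (wk u) (≈-trans (letTens-β (var here) stoup (ren (extR there) a))
          (≡→≈ (trans (st-id _) (ext-var a)))))))))
  (cast≈ refl (st-assoc u (letTens stoup a) w) (letTens-η w (u [ letTens stoup a ]ₛ))))

CC-letBang : ∀ {Γ Δ E S A} (u : Tm Γ (just E) ⌜ S ⌝) (w : Tm Γ Δ ⌜ ! A ⌝) (a : Tm (A ∷ Γ) nothing ⌜ E ⌝) →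
  u [ letBang w a ]ₛ ≈ letBang w (wk u [ a ]ₛ)
CC-letBang u w a = ≈-sym (≈-trans (letBang-cong ≈-refl
    (≈-sym (cast≈ (cong (_[ bang (var here) ]ₛ) (sym (ren-st there u (letBang stoup a))))
                  refl
      (cast≈ (sym (st-assoc (wk u) (letBang stoup (ren (extR there) a)) (bang (var here)))) refl
        (≈-st-r (wk u) (≈-trans (letBang-β (var here) (ren (extR there) a))
          (≡→≈ (ext-var a))))))))
  (cast≈ refl (st-assoc u (letBang stoup a) w) (letBang-η w (u [ letBang stoup a ]ₛ))))

module ≈-Reasoning where
  infix  1 begin_
  infixr 2 _≈⟨_⟩_ _≡⟨_⟩_ _≡˘⟨_⟩_
  infix  3 _∎
  begin_ : ∀ {Γ Δ A} {x y : Tm Γ Δ A} → x ≈ y → x ≈ y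
  begin p = p
  _≈⟨_⟩_ : ∀ {Γ Δ A} (x : Tm Γ Δ A) {y z : Tm Γ Δ A} → x ≈ y → y ≈ z → x ≈ z
  x ≈⟨ p ⟩ q = ≈-trans p q
  _≡⟨_⟩_ : ∀ {Γ Δ A} (x : Tm Γ Δ A) {y z : Tm Γ Δ A} → x ≡ y → y ≈ z → x ≈ z
  x ≡⟨ refl ⟩ q = q
  _≡˘⟨_⟩_ : ∀ {Γ Δ A} (x : Tm Γ Δ A) {y z : Tm Γ Δ A} → y ≡ x → y ≈ z → x ≈ z
  x ≡˘⟨ refl ⟩ q = q
  _∎ : ∀ {Γ Δ A} (x : Tm Γ Δ A) → x ≈ x
  x ∎ = ≈-refl

replace₀ : ∀ {Γ A C} → Tm (C ∷ Γ) nothing A → Sub (A ∷ Γ) (C ∷ Γ)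
replace₀ N here = N
replace₀ N (there x) = var (there x)

ren-single-replace₀ : ∀ {Γ Δ A B C} (M : Tm (A ∷ Γ) Δ B) (N : Tm (C ∷ Γ) nothing A) → (ren (extR there) M) [ N ] ≡ sub (replace₀ N) M
ren-single-replace₀ M N = sub-ren f M
  where
  f : ∀ {D} (x : _ ∋ D) → single N (extR there x) ≡ replace₀ N x
  f here = refl
  f (there x) = refl

replace₀-wk : ∀ {Γ Δ A B C} (t : Tm Γ Δ B) (N : Tm (C ∷ Γ) nothing A) → sub (replace₀ N) (wk t) ≡ wk t
replace₀-wk t N = trans (sub-ren (λ _ → refl) t) (sym (ren-as-sub there t))

app-wk-lam : ∀ {Γ A B C} (M : Tm (A ∷ Γ) nothing B) (N : Tm (C ∷ Γ) nothing A) → app (wk (lam M)) N ≈ sub (replace₀ N) M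
app-wk-lam M N = ≈-trans (lam-β _ N) (≡→≈ (ren-single-replace₀ M N))

capp-wk-clam : ∀ {Γ Δ A Q C} (M : Tm (A ∷ Γ) Δ ⌜ Q ⌝) (N : Tm (C ∷ Γ) nothing A) → capp (wk (clam M)) N ≈ sub (replace₀ N) M
capp-wk-clam M N = ≈-trans (clam-β _ N) (≡→≈ (ren-single-replace₀ M N))

module TranslationLemmas (R : CTy) where
  open Translation R
  TranslatesRen : ∀ {Γ Γ'} → Ren Γ Γ' → Ren (Γ •c) (Γ' •c) → Set
  TranslatesRen {Γ} ρ ρ' = ∀ {B} (x : Γ ∋ B) → ρ' (varᵗ x) ≡ varᵗ (ρ x)

  TranslatesRen-ext : ∀ {Γ Γ' C} {ρ : Ren Γ Γ'} {ρ' : Ren (Γ •c) (Γ' •c)} → TranslatesRen ρ ρ' → TranslatesRen (extR {A = C} ρ) (extR ρ')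
  TranslatesRen-ext h here = refl
  TranslatesRen-ext h (there x) = cong there (h x)

  ren• : ∀ {Γ Γ' A} {ρ : Ren Γ Γ'} {ρ' : Ren (Γ •c) (Γ' •c)} → TranslatesRen ρ ρ' → (t : Tm Γ nothing A) → (ren ρ t) •ᵗ ≡ ren ρ' (t •ᵗ)
  ren° : ∀ {Γ Γ' D P} {ρ : Ren Γ Γ'} {ρ' : Ren (Γ •c) (Γ' •c)} → TranslatesRen ρ ρ' → (t : Tm Γ (just D) ⌜ P ⌝) → (ren ρ t) °ᵗ ≡ ren ρ' (t °ᵗ)
  ren• h (var x) = cong var (sym (h x))
  ren• h unit = refl
  ren• h (pair t u) rewrite ren• h t | ren• h u = refl
  ren• h (fst t) rewrite ren• h t = refl
  ren• h (snd t) rewrite ren• h t = refl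
  ren• h (lam t) rewrite ren• (TranslatesRen-ext h) t = refl
  ren• h (app t u) rewrite ren• h t | ren• h u = refl
  ren• h cunit = refl
  ren• h (cpair t u) rewrite ren• h t | ren• h u = refl
  ren• h (cfst t) rewrite ren• h t = refl
  ren• h (csnd t) rewrite ren• h t = refl
  ren• h (clam t) rewrite ren• (TranslatesRen-ext h) t = refl
  ren• h (capp t u) rewrite ren• h t | ren• h u = refl
  ren• h top = refl
  ren• h (letTop t u) rewrite ren• h t | ren• h u = refl
  ren• h (bang t) rewrite ren• h t = refl
  ren• h (letBang t u) rewrite ren• h t | ren• (TranslatesRen-ext h) u = refl
  ren• h (tens t u) rewrite ren• h t | ren• h u = refl
  ren• h (letTens t u) rewrite ren• h t | ren° (TranslatesRen-ext h) u = refl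
  ren• h (abort t) rewrite ren• h t = refl
  ren• h (inl t) rewrite ren• h t = refl
  ren• h (inr t) rewrite ren• h t = refl
  ren• h (case s t u) rewrite ren• h s | ren° h t | ren° h u = refl
  ren• h (hlam t) rewrite ren° h t = refl
  ren• h (lapp t u) rewrite ren• h t | ren• h u = refl
  ren° h stoup = refl
  ren° h cunit = refl
  ren° h (cpair t u) rewrite ren° h t | ren° h u = refl
  ren° {ρ' = ρ'} h (cfst t) rewrite ren° {ρ' = ρ'} h t = sym (ren-st ρ' (t °ᵗ) (inl stoup))
  ren° {ρ' = ρ'} h (csnd t) rewrite ren° {ρ' = ρ'} h t = sym (ren-st ρ' (t °ᵗ) (inr stoup))
  ren° h (clam t) rewrite ren° (TranslatesRen-ext h) t = refl
  ren° {ρ' = ρ'} h (capp t u) rewrite ren° {ρ' = ρ'} h t | ren• {ρ' = ρ'} h u = sym (ren-st ρ' (t °ᵗ) (tens (u •ᵗ) stoup))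
  ren° {ρ' = ρ'} h (letTop t u) rewrite ren° {ρ' = ρ'} h t | ren• {ρ' = ρ'} h u = sym (ren-st ρ' (t °ᵗ) (lapp (u •ᵗ) stoup))
  ren° {ρ' = ρ'} h (letBang t u) rewrite ren° {ρ' = ρ'} h t | ren• (TranslatesRen-ext h) u = sym (ren-st ρ' (t °ᵗ) (clam (lapp (u •ᵗ) stoup)))
  ren° {ρ' = ρ'} h (tens t u) rewrite ren° {ρ' = ρ'} h u | ren• {ρ' = ρ'} h t = sym (ren-st ρ' (u °ᵗ) (capp stoup (t •ᵗ)))
  ren° {ρ' = ρ'} h (letTens t u) rewrite ren° {ρ' = ρ'} h t | ren° (TranslatesRen-ext h) u = sym (ren-st ρ' (t °ᵗ) (clam (u °ᵗ)))
  ren° {ρ' = ρ'} h (abort t) rewrite ren° {ρ' = ρ'} h t = sym (ren-st ρ' (t °ᵗ) cunit)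
  ren° {ρ' = ρ'} h (inl t) rewrite ren° {ρ' = ρ'} h t = sym (ren-st ρ' (t °ᵗ) (cfst stoup))
  ren° {ρ' = ρ'} h (inr t) rewrite ren° {ρ' = ρ'} h t = sym (ren-st ρ' (t °ᵗ) (csnd stoup))
  ren° {ρ' = ρ'} h
      (case s t u) rewrite ren° {ρ' = ρ'} h s | ren° {ρ' = ρ'} h t | ren° {ρ' = ρ'} h u = sym (ren-st ρ' (s °ᵗ) (cpair (t °ᵗ) (u °ᵗ)))
  ren° {ρ' = ρ'} h (lapp t u) rewrite ren° {ρ' = ρ'} h u | ren• {ρ' = ρ'} h t = sym (ren-st ρ' (u °ᵗ) (lapp (t •ᵗ) stoup))

  wk• : ∀ {Γ A B} (t : Tm Γ nothing A) → (wk {B = B} t) •ᵗ ≡ wk (t •ᵗ)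
  wk• t = ren• (λ _ → refl) t

  wk° : ∀ {Γ D P B} (t : Tm Γ (just D) ⌜ P ⌝) → (wk {B = B} t) °ᵗ ≡ wk (t °ᵗ)
  wk° t = ren° (λ _ → refl) t

  TranslatesSub : ∀ {Γ Γ'} → Sub Γ Γ' → Sub (Γ •c) (Γ' •c) → Set
  TranslatesSub {Γ} σ σ' = ∀ {B} (x : Γ ∋ B) → σ' (varᵗ x) ≡ (σ x) •ᵗ

  TranslatesSub-ext : ∀ {Γ Γ' C} {σ : Sub Γ Γ'} {σ' : Sub (Γ •c) (Γ' •c)} → TranslatesSub σ σ' → TranslatesSub (extS {A = C} σ) (extS σ')
  TranslatesSub-ext h here = refl
  TranslatesSub-ext {σ = σ} h (there x) = trans (cong wk (h x)) (sym (wk• (σ x)))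

  sub• : ∀ {Γ Γ' A} {σ : Sub Γ Γ'} {σ' : Sub (Γ •c) (Γ' •c)} → TranslatesSub σ σ' → (t : Tm Γ nothing A) → (sub σ t) •ᵗ ≡ sub σ' (t •ᵗ)
  sub° : ∀ {Γ Γ' D P} {σ : Sub Γ Γ'} {σ' : Sub (Γ •c) (Γ' •c)} → TranslatesSub σ σ' → (t : Tm Γ (just D) ⌜ P ⌝) → (sub σ t) °ᵗ ≡ sub σ' (t °ᵗ)
  sub• h (var x) = sym (h x)
  sub• h unit = refl
  sub• h (pair t u) rewrite sub• h t | sub• h u = refl
  sub• h (fst t) rewrite sub• h t = refl
  sub• h (snd t) rewrite sub• h t = refl
  sub• h (lam t) rewrite sub• (TranslatesSub-ext h) t = refl
  sub• h (app t u) rewrite sub• h t | sub• h u = refl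
  sub• h cunit = refl
  sub• h (cpair t u) rewrite sub• h t | sub• h u = refl
  sub• h (cfst t) rewrite sub• h t = refl
  sub• h (csnd t) rewrite sub• h t = refl
  sub• h (clam t) rewrite sub• (TranslatesSub-ext h) t = refl
  sub• h (capp t u) rewrite sub• h t | sub• h u = refl
  sub• h top = refl
  sub• h (letTop t u) rewrite sub• h t | sub• h u = refl
  sub• h (bang t) rewrite sub• h t = refl
  sub• h (letBang t u) rewrite sub• h t | sub• (TranslatesSub-ext h) u = refl
  sub• h (tens t u) rewrite sub• h t | sub• h u = refl
  sub• h (letTens t u) rewrite sub• h t | sub° (TranslatesSub-ext h) u = refl
  sub• h (abort t) rewrite sub• h t = refl
  sub• h (inl t) rewrite sub• h t = refl
  sub• h (inr t) rewrite sub• h t = refl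
  sub• h (case s t u) rewrite sub• h s | sub° h t | sub° h u = refl
  sub• h (hlam t) rewrite sub° h t = refl
  sub• h (lapp t u) rewrite sub• h t | sub• h u = refl
  sub° h stoup = refl
  sub° h cunit = refl
  sub° h (cpair t u) rewrite sub° h t | sub° h u = refl
  sub° {σ' = σ'} h (cfst t) rewrite sub° {σ' = σ'} h t = sym (sub-st σ' (t °ᵗ) (inl stoup))
  sub° {σ' = σ'} h (csnd t) rewrite sub° {σ' = σ'} h t = sym (sub-st σ' (t °ᵗ) (inr stoup))
  sub° h (clam t) rewrite sub° (TranslatesSub-ext h) t = refl
  sub° {σ' = σ'} h (capp t u) rewrite sub° {σ' = σ'} h t | sub• {σ' = σ'} h u = sym (sub-st σ' (t °ᵗ) (tens (u •ᵗ) stoup))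
  sub° {σ' = σ'} h (letTop t u) rewrite sub° {σ' = σ'} h t | sub• {σ' = σ'} h u = sym (sub-st σ' (t °ᵗ) (lapp (u •ᵗ) stoup))
  sub° {σ' = σ'} h (letBang t u) rewrite sub° {σ' = σ'} h t | sub• (TranslatesSub-ext h) u = sym (sub-st σ' (t °ᵗ) (clam (lapp (u •ᵗ) stoup)))
  sub° {σ' = σ'} h (tens t u) rewrite sub° {σ' = σ'} h u | sub• {σ' = σ'} h t = sym (sub-st σ' (u °ᵗ) (capp stoup (t •ᵗ)))
  sub° {σ' = σ'} h (letTens t u) rewrite sub° {σ' = σ'} h t | sub° (TranslatesSub-ext h) u = sym (sub-st σ' (t °ᵗ) (clam (u °ᵗ)))
  sub° {σ' = σ'} h (abort t) rewrite sub° {σ' = σ'} h t = sym (sub-st σ' (t °ᵗ) cunit)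
  sub° {σ' = σ'} h (inl t) rewrite sub° {σ' = σ'} h t = sym (sub-st σ' (t °ᵗ) (cfst stoup))
  sub° {σ' = σ'} h (inr t) rewrite sub° {σ' = σ'} h t = sym (sub-st σ' (t °ᵗ) (csnd stoup))
  sub° {σ' = σ'} h
      (case s t u) rewrite sub° {σ' = σ'} h s | sub° {σ' = σ'} h t | sub° {σ' = σ'} h u = sym (sub-st σ' (s °ᵗ) (cpair (t °ᵗ) (u °ᵗ)))
  sub° {σ' = σ'} h (lapp t u) rewrite sub° {σ' = σ'} h u | sub• {σ' = σ'} h t = sym (sub-st σ' (u °ᵗ) (lapp (t •ᵗ) stoup))

  single• : ∀ {Γ A B} (t : Tm (A ∷ Γ) nothing B) (u : Tm Γ nothing A) → (t [ u ]) •ᵗ ≡ (t •ᵗ) [ u •ᵗ ]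
  single• t u = sub• h t
    where
    h : TranslatesSub (single u) (single (u •ᵗ))
    h here = refl
    h (there x) = refl

  single° : ∀ {Γ A D P} (t : Tm (A ∷ Γ) (just D) ⌜ P ⌝) (u : Tm Γ nothing A) → (t [ u ]) °ᵗ ≡ (t °ᵗ) [ u •ᵗ ]
  single° t u = sub° h t
    where
    h : TranslatesSub (single u) (single (u •ᵗ))
    h here = refl
    h (there x) = refl

  hlam-β-stoup : ∀ {Γ D S} (X : Tm Γ (just D) ⌜ S ⌝) → lapp (hlam X) stoup ≈ X
  hlam-β-stoup X = ≈-trans (hlam-β X stoup) (≡→≈ (st-id X))

  -- The cases cunit, cpair and
  -- clam, translated to eliminators of 0, ⊕ and !⊗, use the commuting conversions.
  °-st : ∀ {Γ D E P} (t : Tm Γ (just D) ⌜ P ⌝) (s : Tm Γ (just E) ⌜ D ⌝) → (t [ s ]ₛ) °ᵗ ≈ (s °ᵗ) [ t °ᵗ ]ₛ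
  °-st stoup s = ≈-sym (≡→≈ (st-id _))
  °-st cunit s = ≈-sym (CC-abort (s °ᵗ) stoup)
  °-st (cpair a b) s = ≈-trans (case-cong ≈-refl (°-st a s) (°-st b s)) (≈-sym (CC-case (s °ᵗ) stoup (a °ᵗ) (b °ᵗ)))
  °-st (cfst a) s = st-push (s °ᵗ) (a °ᵗ) (inl stoup) (°-st a s)
  °-st (csnd a) s = st-push (s °ᵗ) (a °ᵗ) (inr stoup) (°-st a s)
  °-st (clam a) s = ≈-trans (letTens-cong ≈-refl (≈-trans (°-st a (wk s)) (≡→≈ (cong (_[ a °ᵗ ]ₛ) (wk° s)))))
      (≈-sym (CC-letTens (s °ᵗ) stoup (a °ᵗ)))
  °-st (capp a u) s = st-push (s °ᵗ) (a °ᵗ) (tens (u •ᵗ) stoup) (°-st a s)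
  °-st (letTop a u) s = st-push (s °ᵗ) (a °ᵗ) (lapp (u •ᵗ) stoup) (°-st a s)
  °-st (letBang a u) s = st-push (s °ᵗ) (a °ᵗ) (clam (lapp (u •ᵗ) stoup)) (°-st a s)
  °-st (tens a u) s = st-push (s °ᵗ) (u °ᵗ) (capp stoup (a •ᵗ)) (°-st u s)
  °-st (letTens a u) s = st-push (s °ᵗ) (a °ᵗ) (clam (u °ᵗ)) (°-st a s)
  °-st (abort a) s = st-push (s °ᵗ) (a °ᵗ) cunit (°-st a s)
  °-st (inl a) s = st-push (s °ᵗ) (a °ᵗ) (cfst stoup) (°-st a s)
  °-st (inr a) s = st-push (s °ᵗ) (a °ᵗ) (csnd stoup) (°-st a s)
  °-st (case r a b) s = st-push (s °ᵗ) (r °ᵗ) (cpair (a °ᵗ) (b °ᵗ)) (°-st r s)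
  °-st (lapp a u) s = st-push (s °ᵗ) (u °ᵗ) (lapp (a •ᵗ) stoup) (°-st u s)

  •-st : ∀ {Γ D P} (t : Tm Γ (just D) ⌜ P ⌝) (s : Tm Γ nothing ⌜ D ⌝) → (t [ s ]ₛ) •ᵗ ≈ hlam (lapp (s •ᵗ) (t °ᵗ))
  •-st stoup s = ≈-sym (hlam-η _)
  •-st cunit s = hlam-cong (≈-sym (CC-abort (lapp (s •ᵗ) stoup) stoup))
  •-st (cpair a b) s = hlam-cong (≈-trans (case-cong ≈-refl
      (≈-trans (lapp-cong (•-st a s) ≈-refl) (hlam-β-stoup _))
      (≈-trans (lapp-cong (•-st b s) ≈-refl) (hlam-β-stoup _)))
    (≈-sym (CC-case (lapp (s •ᵗ) stoup) stoup (a °ᵗ) (b °ᵗ))))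
  •-st (cfst a) s = hlam-cong (≈-trans (lapp-cong (•-st a s) ≈-refl) (hlam-β _ _))
  •-st (csnd a) s = hlam-cong (≈-trans (lapp-cong (•-st a s) ≈-refl) (hlam-β _ _))
  •-st (clam a) s = hlam-cong (≈-trans (letTens-cong ≈-refl
      (≈-trans (lapp-cong (•-st a (wk s)) ≈-refl) (≈-trans (hlam-β-stoup _) (≡→≈ (cong (λ x → lapp x (a °ᵗ)) (wk• s))))))
    (≈-sym (CC-letTens (lapp (s •ᵗ) stoup) stoup (a °ᵗ))))
  •-st (capp a u) s = hlam-cong (≈-trans (lapp-cong (•-st a s) ≈-refl) (hlam-β _ _))
  •-st (letTop a u) s = hlam-cong (≈-trans (lapp-cong (•-st a s) ≈-refl) (hlam-β _ _))
  •-st (letBang a u) s = hlam-cong (≈-trans (lapp-cong (•-st a s) ≈-refl) (hlam-β _ _))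
  •-st (tens a u) s = hlam-cong (≈-trans (lapp-cong (•-st u s) ≈-refl) (hlam-β _ _))
  •-st (letTens a u) s = hlam-cong (≈-trans (lapp-cong (•-st a s) ≈-refl) (hlam-β _ _))
  •-st (abort a) s = hlam-cong (≈-trans (lapp-cong (•-st a s) ≈-refl) (hlam-β _ _))
  •-st (inl a) s = hlam-cong (≈-trans (lapp-cong (•-st a s) ≈-refl) (hlam-β _ _))
  •-st (inr a) s = hlam-cong (≈-trans (lapp-cong (•-st a s) ≈-refl) (hlam-β _ _))
  •-st (case r a b) s = hlam-cong (≈-trans (lapp-cong (•-st r s) ≈-refl) (hlam-β _ _))
  •-st (lapp a u) s = hlam-cong (≈-trans (lapp-cong (•-st u s) ≈-refl) (hlam-β _ _))

  •-top-inst : ∀ {Γ P} (u : Tm Γ (just I) ⌜ P ⌝) → lapp ((u [ top ]ₛ) •ᵗ) stoup ≈ u °ᵗ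
  •-top-inst u = ≈-trans (lapp-cong (•-st u top) ≈-refl) (≈-trans (hlam-β-stoup _) (hlam-β stoup (u °ᵗ)))

  •-bang-inst : ∀ {Γ A Q} (u : Tm Γ (just (! A)) ⌜ Q ⌝) → lapp ((wk u [ bang (var here) ]ₛ) •ᵗ) stoup ≈ capp (wk (u °ᵗ)) (var here)
  •-bang-inst u = ≈-trans (lapp-cong (•-st (wk u) (bang (var here))) ≈-refl)
    (≈-trans (hlam-β-stoup _) (≈-trans (hlam-β _ _) (≡→≈ (cong (λ x → capp x (var here)) (wk° u)))))

  °-tens-inst : ∀ {Γ A Q S} (u : Tm Γ (just (! A ⊗ Q)) ⌜ S ⌝) → (wk u [ tens (var here) stoup ]ₛ) °ᵗ ≈ capp (wk (u °ᵗ)) (var here)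
  °-tens-inst u = ≈-trans (°-st (wk u) (tens (var here) stoup)) (≡→≈ (cong (λ x → capp x (var here)) (wk° u)))

  sound• : ∀ {Γ A} {t u : Tm Γ nothing A} → t ≈ u → t •ᵗ ≈ u •ᵗ
  sound° : ∀ {Γ D P} {t u : Tm Γ (just D) ⌜ P ⌝} → t ≈ u → t °ᵗ ≈ u °ᵗ
  sound• ≈-refl = ≈-refl
  sound• (≈-sym p) = ≈-sym (sound• p)
  sound• (≈-trans p q) = ≈-trans (sound• p) (sound• q)
  sound• (pair-cong p q) = pair-cong (sound• p) (sound• q)
  sound• (fst-cong p) = fst-cong (sound• p)
  sound• (snd-cong p) = snd-cong (sound• p)
  sound• (lam-cong p) = lam-cong (sound• p)
  sound• (app-cong p q) = app-cong (sound• p) (sound• q)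
  sound• (cpair-cong p q) = hlam-cong (case-cong ≈-refl (lapp-cong (sound• p) ≈-refl) (lapp-cong (sound• q) ≈-refl))
  sound• (cfst-cong p) = hlam-cong (lapp-cong (sound• p) ≈-refl)
  sound• (csnd-cong p) = hlam-cong (lapp-cong (sound• p) ≈-refl)
  sound• (clam-cong p) = hlam-cong (letTens-cong ≈-refl (lapp-cong (sound• p) ≈-refl))
  sound• (capp-cong p q) = hlam-cong (lapp-cong (sound• p) (tens-cong (sound• q) ≈-refl))
  sound• (letTop-cong p q) = hlam-cong (lapp-cong (sound• p) (lapp-cong (sound• q) ≈-refl))
  sound• (bang-cong p) = hlam-cong (capp-cong ≈-refl (sound• p))
  sound• (letBang-cong p q) = hlam-cong (lapp-cong (sound• p) (clam-cong (lapp-cong (sound• q) ≈-refl)))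
  sound• (tens-cong p q) = hlam-cong (lapp-cong (sound• q) (capp-cong ≈-refl (sound• p)))
  sound• (letTens-cong p q) = hlam-cong (lapp-cong (sound• p) (clam-cong (sound° q)))
  sound• (abort-cong p) = hlam-cong (lapp-cong (sound• p) ≈-refl)
  sound• (inl-cong p) = hlam-cong (lapp-cong (sound• p) ≈-refl)
  sound• (inr-cong p) = hlam-cong (lapp-cong (sound• p) ≈-refl)
  sound• (case-cong p q r) = hlam-cong (lapp-cong (sound• p) (cpair-cong (sound° q) (sound° r)))
  sound• (hlam-cong p) = hlam-cong (sound° p)
  sound• (lapp-cong p q) = hlam-cong (lapp-cong (sound• q) (lapp-cong (sound• p) ≈-refl))
  sound• (one-η t) = one-η _
  sound• (fst-β t u) = fst-β _ _
  sound• (snd-β t u) = snd-β _ _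
  sound• (pair-η t) = pair-η _
  sound• (lam-β t u) = cast≈ refl (sym (single• t u)) (lam-β _ _)
  sound• (lam-η t) = cast≈ (cong (λ x → lam (app x (var here))) (sym (wk• t))) refl (lam-η _)
  sound• (One-η t) = ≈-trans (≈-sym (hlam-η _)) (hlam-cong (≈-trans (≡→≈ (sym (st-id _))) (≈-sym (abort-η stoup (lapp (t •ᵗ) stoup)))))
  sound• (cfst-β t u) = ≈-trans (hlam-cong (≈-trans (hlam-β _ _) (case-βl _ _ _))) (hlam-η _)
  sound• (csnd-β t u) = ≈-trans (hlam-cong (≈-trans (hlam-β _ _) (case-βr _ _ _))) (hlam-η _)
  sound• (cpair-η t) = ≈-trans
      (hlam-cong (≈-trans (case-cong ≈-refl (hlam-β-stoup _) (hlam-β-stoup _)) (case-η stoup (lapp (t •ᵗ) stoup)))) (hlam-η _)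
  sound• (clam-β t u) = cast≈ refl (sym (single• t u)) (≈-trans (hlam-cong (≈-trans (hlam-β _ _) (letTens-β _ _ _))) (hlam-η _))
  sound• (clam-η t) = ≈-trans
      (hlam-cong (≈-trans (letTens-cong ≈-refl (≈-trans (hlam-β-stoup _) (≡→≈ (cong (λ x → lapp x (tens (var here) stoup)) (wk• t))))) (letTens-η stoup (lapp (t •ᵗ) stoup)))) (hlam-η _)
  sound• (letTop-β t) = ≈-trans (hlam-cong (hlam-β _ _)) (hlam-η _)
  sound• (letTop-η t u) = ≈-trans (hlam-cong (lapp-cong ≈-refl (•-top-inst u))) (≈-sym (•-st u t))
  sound• (letBang-β t u) = cast≈ refl (sym (single• u t)) (≈-trans (hlam-cong (≈-trans (hlam-β _ _) (clam-β _ _))) (hlam-η _))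
  sound• (letBang-η t u) = ≈-trans (hlam-cong (lapp-cong ≈-refl (≈-trans (clam-cong (•-bang-inst u)) (clam-η _)))) (≈-sym (•-st u t))
  sound• (letTens-β t s u) = ≈-trans
      (hlam-cong (≈-trans (hlam-β _ _) (lapp-cong ≈-refl (≈-trans (clam-β _ _) (≡→≈ (sym (single° u t))))))) (≈-sym (•-st (u [ t ]) s))
  sound• (letTens-η t u) = ≈-trans (hlam-cong (lapp-cong ≈-refl (≈-trans (clam-cong (°-tens-inst u)) (clam-η _)))) (≈-sym (•-st u t))
  sound• (abort-η t u) = ≈-trans (hlam-cong (lapp-cong ≈-refl (≈-sym (One-η _)))) (≈-sym (•-st u t))
  sound• (case-βl t u u') = ≈-trans (hlam-cong (≈-trans (hlam-β _ _) (lapp-cong ≈-refl (cfst-β _ _)))) (≈-sym (•-st u t))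
  sound• (case-βr t u u') = ≈-trans (hlam-cong (≈-trans (hlam-β _ _) (lapp-cong ≈-refl (csnd-β _ _)))) (≈-sym (•-st u' t))
  sound• (case-η t u) = ≈-trans
      (hlam-cong (lapp-cong ≈-refl (≈-trans (cpair-cong (°-st u (inl stoup)) (°-st u (inr stoup))) (cpair-η _)))) (≈-sym (•-st u t))
  sound• (hlam-β t u) = ≈-trans (hlam-cong (lapp-cong ≈-refl (hlam-β-stoup _))) (≈-sym (•-st t u))
  sound• (hlam-η t) = hlam-η _
  sound° ≈-refl = ≈-refl
  sound° (≈-sym p) = ≈-sym (sound° p)
  sound° (≈-trans p q) = ≈-trans (sound° p) (sound° q)
  sound° (cpair-cong p q) = case-cong ≈-refl (sound° p) (sound° q)
  sound° (cfst-cong p) = ≈-st-l (sound° p) (inl stoup)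
  sound° (csnd-cong p) = ≈-st-l (sound° p) (inr stoup)
  sound° (clam-cong p) = letTens-cong ≈-refl (sound° p)
  sound° (capp-cong p q) = ≈-st (sound° p) (tens-cong (sound• q) ≈-refl)
  sound° (letTop-cong p q) = ≈-st (sound° p) (lapp-cong (sound• q) ≈-refl)
  sound° (letBang-cong p q) = ≈-st (sound° p) (clam-cong (lapp-cong (sound• q) ≈-refl))
  sound° (tens-cong p q) = ≈-st (sound° q) (capp-cong ≈-refl (sound• p))
  sound° (letTens-cong p q) = ≈-st (sound° p) (clam-cong (sound° q))
  sound° (abort-cong p) = ≈-st-l (sound° p) cunit
  sound° (inl-cong p) = ≈-st-l (sound° p) (cfst stoup)
  sound° (inr-cong p) = ≈-st-l (sound° p) (csnd stoup)
  sound° (case-cong p q r) = ≈-st (sound° p) (cpair-cong (sound° q) (sound° r))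
  sound° (lapp-cong p q) = ≈-st (sound° q) (lapp-cong (sound• p) ≈-refl)
  sound° (One-η t) = ≈-trans (≡→≈ (sym (st-id _))) (≈-sym (abort-η stoup (t °ᵗ)))
  sound° (cfst-β t u) = ≈-trans (case-βl stoup _ _) (≡→≈ (st-id _))
  sound° (csnd-β t u) = ≈-trans (case-βr stoup _ _) (≡→≈ (st-id _))
  sound° (cpair-η t) = ≈-trans (case-η stoup (t °ᵗ)) (≡→≈ (st-id _))
  sound° (clam-β t u) = cast≈ refl (trans (st-id _) (sym (single° t u))) (letTens-β _ _ _)
  sound° (clam-η t) = cast≈ (cong (λ x → letTens stoup (x [ tens (var here) stoup ]ₛ)) (sym (wk° t))) (st-id _) (letTens-η stoup (t °ᵗ))
  sound° (letTop-η t u) = ≈-trans (≈-st-r (t °ᵗ) (•-top-inst u)) (≈-sym (°-st u t))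
  sound° (letBang-η t u) = ≈-trans (≈-st-r (t °ᵗ) (≈-trans (clam-cong (•-bang-inst u)) (clam-η _))) (≈-sym (°-st u t))
  sound° (letTens-β t s u) = ≈-trans (≡→≈ (st-assoc (s °ᵗ) (capp stoup (t •ᵗ)) (clam (u °ᵗ))))
      (≈-trans (≈-st-r (s °ᵗ) (≈-trans (clam-β _ _) (≡→≈ (sym (single° u t))))) (≈-sym (°-st (u [ t ]) s)))
  sound° (letTens-η t u) = ≈-trans (≈-st-r (t °ᵗ) (≈-trans (clam-cong (°-tens-inst u)) (clam-η _))) (≈-sym (°-st u t))
  sound° (abort-η t u) = ≈-trans (≈-st-r (t °ᵗ) (≈-sym (One-η _))) (≈-sym (°-st u t))
  sound° (case-βl t u u') = ≈-trans (≡→≈ (st-assoc (t °ᵗ) (cfst stoup) (cpair (u °ᵗ) (u' °ᵗ))))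
      (≈-trans (≈-st-r (t °ᵗ) (cfst-β _ _)) (≈-sym (°-st u t)))
  sound° (case-βr t u u') = ≈-trans (≡→≈ (st-assoc (t °ᵗ) (csnd stoup) (cpair (u °ᵗ) (u' °ᵗ))))
      (≈-trans (≈-st-r (t °ᵗ) (csnd-β _ _)) (≈-sym (°-st u' t)))
  sound° (case-η t u) = ≈-trans (≈-st-r (t °ᵗ) (≈-trans (cpair-cong (°-st u (inl stoup)) (°-st u (inr stoup))) (cpair-η _)))
      (≈-sym (°-st u t))
  sound° (hlam-β t u) = ≈-trans (≈-st-r (u °ᵗ) (hlam-β-stoup _)) (≈-sym (°-st t u))

castˢ : ∀ {Γ X Y} → X ≡ Y → Tm Γ (just X) ⌜ Y ⌝
castˢ refl = stoup

castˢ-sub : ∀ {Γ Γ' X Y} (σ : Sub Γ Γ') (p : X ≡ Y) → sub σ (castˢ p) ≡ castˢ p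
castˢ-sub σ refl = refl

castˢ-inv : ∀ {Γ X Y} (p : X ≡ Y) → castˢ {Γ} p [ castˢ (sym p) ]ₛ ≡ stoup
castˢ-inv refl = refl

castˢ-inv' : ∀ {Γ X Y} (p : X ≡ Y) → castˢ {Γ} (sym p) [ castˢ p ]ₛ ≡ stoup
castˢ-inv' refl = refl

module Involution (R : CTy) (R°≡I : Translation._° R R ≡ I)
                  (ccon°° : ∀ m → Translation._° R (Translation._° R (ccon m)) ≡ ccon m) where
  open Translation R
  open TranslationLemmas R
  κ : ∀ {Γ} → Tm Γ (just I) ⌜ R ° ⌝
  κ = castˢ (sym R°≡I)

  κ⁻ : ∀ {Γ} → Tm Γ (just (R °)) ⌜ I ⌝
  κ⁻ = castˢ R°≡I

  top° : ∀ {Γ} → Tm Γ nothing ⌜ R ° ⌝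
  top° = κ [ top ]ₛ

  φ  : (A : VTy) → ∀ {Γ} → Tm Γ nothing A → Tm Γ nothing (A • •)
  φ⁻ : (A : VTy) → ∀ {Γ} → Tm Γ nothing (A • •) → Tm Γ nothing A
  Ψ  : (P : CTy) → ∀ {Γ} → Tm Γ (just P) ⌜ P ° ° ⌝
  Ψ⁻ : (P : CTy) → ∀ {Γ} → Tm Γ (just (P ° °)) ⌜ P ⌝

  φ (vcon n) t = t
  φ one t = t
  φ (A ×ᵥ B) t = pair (φ A (fst t)) (φ B (snd t))
  φ (A →ᵥ B) t = lam (φ B (app (wk t) (φ⁻ A (var here))))
  φ ⌜ P ⌝ t = hlam (letTop κ⁻ (Ψ P [ t ]ₛ))
  φ (P ⊸ Q) t = hlam (Ψ Q [ lapp t (Ψ⁻ P) ]ₛ)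

  φ⁻ (vcon n) t = t
  φ⁻ one t = t
  φ⁻ (A ×ᵥ B) t = pair (φ⁻ A (fst t)) (φ⁻ B (snd t))
  φ⁻ (A →ᵥ B) t = lam (φ⁻ B (app (wk t) (φ A (var here))))
  φ⁻ ⌜ P ⌝ t = Ψ⁻ P [ lapp t top° ]ₛ
  φ⁻ (P ⊸ Q) t = hlam (Ψ⁻ Q [ lapp t (Ψ P) ]ₛ)

  Ψ (ccon m) = castˢ (sym (ccon°° m))
  Ψ One = stoup
  Ψ (P & Q) = cpair (Ψ P [ cfst stoup ]ₛ) (Ψ Q [ csnd stoup ]ₛ)
  Ψ (A ⇒ Q) = clam (Ψ Q [ capp stoup (φ⁻ A (var here)) ]ₛ)
  Ψ I = κ
  Ψ (! A) = letBang stoup (tens (φ A (var here)) top°)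
  Ψ (! A ⊗ Q) = letTens stoup (tens (φ A (var here)) (Ψ Q))
  Ψ Zero = stoup
  Ψ (P ⊕ Q) = case stoup (inl (Ψ P)) (inr (Ψ Q))

  Ψ⁻ (ccon m) = castˢ (ccon°° m)
  Ψ⁻ One = stoup
  Ψ⁻ (P & Q) = cpair (Ψ⁻ P [ cfst stoup ]ₛ) (Ψ⁻ Q [ csnd stoup ]ₛ)
  Ψ⁻ (A ⇒ Q) = clam (Ψ⁻ Q [ capp stoup (φ A (var here)) ]ₛ)
  Ψ⁻ I = κ⁻
  Ψ⁻ (! A) = letTens stoup (letTop κ⁻ (bang (φ⁻ A (var here))))
  Ψ⁻ (! A ⊗ Q) = letTens stoup (tens (φ⁻ A (var here)) (Ψ⁻ Q))
  Ψ⁻ Zero = stoup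
  Ψ⁻ (P ⊕ Q) = case stoup (inl (Ψ⁻ P)) (inr (Ψ⁻ Q))

  -- The isomorphisms contain no free context variables: they are stable under
  -- substitution and renaming.
  top°-sub : ∀ {Γ Γ'} (σ : Sub Γ Γ') → sub σ (top° {Γ}) ≡ top°
  top°-sub σ = trans (sub-st σ κ top) (cong (_[ top ]ₛ) (castˢ-sub σ (sym R°≡I)))

  φ-sub  : (A : VTy) → ∀ {Γ Γ'} (σ : Sub Γ Γ') (t : Tm Γ nothing A) → sub σ (φ A t) ≡ φ A (sub σ t)
  φ⁻-sub : (A : VTy) → ∀ {Γ Γ'} (σ : Sub Γ Γ') (t : Tm Γ nothing (A • •)) → sub σ (φ⁻ A t) ≡ φ⁻ A (sub σ t)
  Ψ-sub  : (P : CTy) → ∀ {Γ Γ'} (σ : Sub Γ Γ') → sub σ (Ψ P {Γ}) ≡ Ψ P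
  Ψ⁻-sub : (P : CTy) → ∀ {Γ Γ'} (σ : Sub Γ Γ') → sub σ (Ψ⁻ P {Γ}) ≡ Ψ⁻ P

  φ-sub (vcon n) σ t = refl
  φ-sub one σ t = refl
  φ-sub (A ×ᵥ B) σ t = cong₂ pair (φ-sub A σ (fst t)) (φ-sub B σ (snd t))
  φ-sub (A →ᵥ B) σ t = cong lam (trans (φ-sub B (extS σ) _) (cong (φ B) (cong₂ app (wk-sub σ t) (φ⁻-sub A (extS σ) (var here)))))
  φ-sub ⌜ P ⌝ σ t = cong hlam (cong₂ letTop (castˢ-sub σ R°≡I) (sub-st-with (Ψ P) t (Ψ-sub P σ)))
  φ-sub (P ⊸ Q) σ t = cong hlam
      (trans (sub-st-with (Ψ Q) (lapp t (Ψ⁻ P)) (Ψ-sub Q σ)) (cong (λ x → Ψ Q [ lapp (sub σ t) x ]ₛ) (Ψ⁻-sub P σ)))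

  φ⁻-sub (vcon n) σ t = refl
  φ⁻-sub one σ t = refl
  φ⁻-sub (A ×ᵥ B) σ t = cong₂ pair (φ⁻-sub A σ (fst t)) (φ⁻-sub B σ (snd t))
  φ⁻-sub (A →ᵥ B) σ t = cong lam (trans (φ⁻-sub B (extS σ) _) (cong (φ⁻ B) (cong₂ app (wk-sub σ t) (φ-sub A (extS σ) (var here)))))
  φ⁻-sub ⌜ P ⌝ σ t = trans (sub-st-with (Ψ⁻ P) (lapp t top°) (Ψ⁻-sub P σ)) (cong (λ x → Ψ⁻ P [ lapp (sub σ t) x ]ₛ) (top°-sub σ))
  φ⁻-sub (P ⊸ Q) σ t = cong hlam
      (trans (sub-st-with (Ψ⁻ Q) (lapp t (Ψ P)) (Ψ⁻-sub Q σ)) (cong (λ x → Ψ⁻ Q [ lapp (sub σ t) x ]ₛ) (Ψ-sub P σ)))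

  Ψ-sub (ccon m) σ = castˢ-sub σ _
  Ψ-sub One σ = refl
  Ψ-sub (P & Q) σ = cong₂ cpair (sub-st-with (Ψ P) (cfst stoup) (Ψ-sub P σ)) (sub-st-with (Ψ Q) (csnd stoup) (Ψ-sub Q σ))
  Ψ-sub (A ⇒ Q) σ = cong clam
      (trans (sub-st-with (Ψ Q) (capp stoup (φ⁻ A (var here))) (Ψ-sub Q (extS σ))) (cong (λ x → Ψ Q [ capp stoup x ]ₛ) (φ⁻-sub A (extS σ) (var here))))
  Ψ-sub I σ = castˢ-sub σ _
  Ψ-sub (! A) σ = cong (letBang stoup) (cong₂ tens (φ-sub A (extS σ) (var here)) (top°-sub (extS σ)))
  Ψ-sub (! A ⊗ Q) σ = cong (letTens stoup) (cong₂ tens (φ-sub A (extS σ) (var here)) (Ψ-sub Q (extS σ)))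
  Ψ-sub Zero σ = refl
  Ψ-sub (P ⊕ Q) σ = cong₂ (λ a b → case stoup (inl a) (inr b)) (Ψ-sub P σ) (Ψ-sub Q σ)

  Ψ⁻-sub (ccon m) σ = castˢ-sub σ _
  Ψ⁻-sub One σ = refl
  Ψ⁻-sub (P & Q) σ = cong₂ cpair (sub-st-with (Ψ⁻ P) (cfst stoup) (Ψ⁻-sub P σ)) (sub-st-with (Ψ⁻ Q) (csnd stoup) (Ψ⁻-sub Q σ))
  Ψ⁻-sub (A ⇒ Q) σ = cong clam
      (trans (sub-st-with (Ψ⁻ Q) (capp stoup (φ A (var here))) (Ψ⁻-sub Q (extS σ))) (cong (λ x → Ψ⁻ Q [ capp stoup x ]ₛ) (φ-sub A (extS σ) (var here))))
  Ψ⁻-sub I σ = castˢ-sub σ _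
  Ψ⁻-sub (! A) σ = cong (letTens stoup) (cong₂ (λ a b → letTop a (bang b)) (castˢ-sub (extS σ) R°≡I) (φ⁻-sub A (extS σ) (var here)))
  Ψ⁻-sub (! A ⊗ Q) σ = cong (letTens stoup) (cong₂ tens (φ⁻-sub A (extS σ) (var here)) (Ψ⁻-sub Q (extS σ)))
  Ψ⁻-sub Zero σ = refl
  Ψ⁻-sub (P ⊕ Q) σ = cong₂ (λ a b → case stoup (inl a) (inr b)) (Ψ⁻-sub P σ) (Ψ⁻-sub Q σ)

  φ-ren : (A : VTy) → ∀ {Γ Γ'} (ρ : Ren Γ Γ') (t : Tm Γ nothing A) → ren ρ (φ A t) ≡ φ A (ren ρ t)
  φ-ren A ρ t = trans (ren-as-sub ρ _) (trans (φ-sub A _ t) (cong (φ A) (sym (ren-as-sub ρ t))))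

  φ⁻-ren : (A : VTy) → ∀ {Γ Γ'} (ρ : Ren Γ Γ') (t : Tm Γ nothing (A • •)) → ren ρ (φ⁻ A t) ≡ φ⁻ A (ren ρ t)
  φ⁻-ren A ρ t = trans (ren-as-sub ρ _) (trans (φ⁻-sub A _ t) (cong (φ⁻ A) (sym (ren-as-sub ρ t))))

  Ψ-ren : (P : CTy) → ∀ {Γ Γ'} (ρ : Ren Γ Γ') → ren ρ (Ψ P {Γ}) ≡ Ψ P
  Ψ-ren P ρ = trans (ren-as-sub ρ _) (Ψ-sub P _)

  Ψ⁻-ren : (P : CTy) → ∀ {Γ Γ'} (ρ : Ren Γ Γ') → ren ρ (Ψ⁻ P {Γ}) ≡ Ψ⁻ P
  Ψ⁻-ren P ρ = trans (ren-as-sub ρ _) (Ψ⁻-sub P _)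

  φ-cong  : (A : VTy) → ∀ {Γ} {t t' : Tm Γ nothing A} → t ≈ t' → φ A t ≈ φ A t'
  φ⁻-cong : (A : VTy) → ∀ {Γ} {t t' : Tm Γ nothing (A • •)} → t ≈ t' → φ⁻ A t ≈ φ⁻ A t'
  φ-cong (vcon n) p = p
  φ-cong one p = p
  φ-cong (A ×ᵥ B) p = pair-cong (φ-cong A (fst-cong p)) (φ-cong B (snd-cong p))
  φ-cong (A →ᵥ B) p = lam-cong (φ-cong B (app-cong (≈-wk p) ≈-refl))
  φ-cong ⌜ P ⌝ p = hlam-cong (letTop-cong ≈-refl (≈-st-r (Ψ P) p))
  φ-cong (P ⊸ Q) p = hlam-cong (≈-st-r (Ψ Q) (lapp-cong p ≈-refl))
  φ⁻-cong (vcon n) p = p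
  φ⁻-cong one p = p
  φ⁻-cong (A ×ᵥ B) p = pair-cong (φ⁻-cong A (fst-cong p)) (φ⁻-cong B (snd-cong p))
  φ⁻-cong (A →ᵥ B) p = lam-cong (φ⁻-cong B (app-cong (≈-wk p) ≈-refl))
  φ⁻-cong ⌜ P ⌝ p = ≈-st-r (Ψ⁻ P) (lapp-cong p ≈-refl)
  φ⁻-cong (P ⊸ Q) p = hlam-cong (≈-st-r (Ψ⁻ Q) (lapp-cong p ≈-refl))

  κ⁻-top° : ∀ {Γ} → κ⁻ {Γ} [ top° ]ₛ ≡ top
  κ⁻-top° = trans (sym (st-assoc κ⁻ κ top)) (cong (_[ top ]ₛ) (castˢ-inv R°≡I))

  κ-κ⁻ : ∀ {Γ} → κ {Γ} [ κ⁻ ]ₛ ≡ stoup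
  κ-κ⁻ = castˢ-inv' R°≡I

  κ⁻-κ : ∀ {Γ} → κ⁻ {Γ} [ κ ]ₛ ≡ stoup
  κ⁻-κ = castˢ-inv R°≡I

  open ≈-Reasoning

  φ⁻φ : (A : VTy) → ∀ {Γ} (t : Tm Γ nothing A) → φ⁻ A (φ A t) ≈ t
  φφ⁻ : (A : VTy) → ∀ {Γ} (t : Tm Γ nothing (A • •)) → φ A (φ⁻ A t) ≈ t
  Ψ⁻Ψ : (P : CTy) → ∀ {Γ} → Ψ⁻ P {Γ} [ Ψ P ]ₛ ≈ stoup
  ΨΨ⁻ : (P : CTy) → ∀ {Γ} → Ψ P {Γ} [ Ψ⁻ P ]ₛ ≈ stoup

  φ⁻φ (vcon n) t = ≈-refl
  φ⁻φ one t = ≈-refl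
  φ⁻φ (A ×ᵥ B) t = ≈-trans
      (pair-cong (≈-trans (φ⁻-cong A (fst-β _ _)) (φ⁻φ A (fst t))) (≈-trans (φ⁻-cong B (snd-β _ _)) (φ⁻φ B (snd t)))) (pair-η t)
  φ⁻φ (A →ᵥ B) t = ≈-trans (lam-cong (begin
      φ⁻ B (app (wk (lam (φ B (app (wk t) (φ⁻ A (var here)))))) (φ A (var here)))
        ≈⟨ φ⁻-cong B (app-wk-lam _ _) ⟩
      φ⁻ B (sub (replace₀ (φ A (var here))) (φ B (app (wk t) (φ⁻ A (var here)))))
        ≡⟨ cong (φ⁻ B) (trans (φ-sub B _ _) (cong (φ B) (cong₂ app (replace₀-wk t _) (φ⁻-sub A _ (var here))))) ⟩
      φ⁻ B (φ B (app (wk t) (φ⁻ A (φ A (var here)))))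
        ≈⟨ φ⁻φ B _ ⟩
      app (wk t) (φ⁻ A (φ A (var here)))
        ≈⟨ app-cong ≈-refl (φ⁻φ A (var here)) ⟩
      app (wk t) (var here) ∎)) (lam-η t)
  φ⁻φ ⌜ P ⌝ t = begin
      Ψ⁻ P [ lapp (hlam (letTop κ⁻ (Ψ P [ t ]ₛ))) top° ]ₛ
        ≈⟨ ≈-st-r (Ψ⁻ P) (hlam-β _ _) ⟩
      Ψ⁻ P [ letTop (κ⁻ [ top° ]ₛ) (Ψ P [ t ]ₛ) ]ₛ
        ≡⟨ cong (λ x → Ψ⁻ P [ letTop x (Ψ P [ t ]ₛ) ]ₛ) κ⁻-top° ⟩
      Ψ⁻ P [ letTop top (Ψ P [ t ]ₛ) ]ₛ
        ≈⟨ ≈-st-r (Ψ⁻ P) (letTop-β _) ⟩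
      Ψ⁻ P [ Ψ P [ t ]ₛ ]ₛ
        ≡˘⟨ st-assoc (Ψ⁻ P) (Ψ P) t ⟩
      (Ψ⁻ P [ Ψ P ]ₛ) [ t ]ₛ
        ≈⟨ ≈-st-l (Ψ⁻Ψ P) t ⟩
      t ∎
  φ⁻φ (P ⊸ Q) t = begin
      hlam (Ψ⁻ Q [ lapp (hlam (Ψ Q [ lapp t (Ψ⁻ P) ]ₛ)) (Ψ P) ]ₛ)
        ≈⟨ hlam-cong (≈-st-r (Ψ⁻ Q) (hlam-β _ _)) ⟩
      hlam (Ψ⁻ Q [ (Ψ Q [ lapp t (Ψ⁻ P) ]ₛ) [ Ψ P ]ₛ ]ₛ)
        ≡⟨ cong (λ x → hlam (Ψ⁻ Q [ x ]ₛ)) (st-assoc (Ψ Q) (lapp t (Ψ⁻ P)) (Ψ P)) ⟩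
      hlam (Ψ⁻ Q [ Ψ Q [ lapp t (Ψ⁻ P [ Ψ P ]ₛ) ]ₛ ]ₛ)
        ≈⟨ hlam-cong (≈-st-r (Ψ⁻ Q) (≈-st-r (Ψ Q) (lapp-cong ≈-refl (Ψ⁻Ψ P)))) ⟩
      hlam (Ψ⁻ Q [ Ψ Q [ lapp t stoup ]ₛ ]ₛ)
        ≡˘⟨ cong hlam (st-assoc (Ψ⁻ Q) (Ψ Q) (lapp t stoup)) ⟩
      hlam ((Ψ⁻ Q [ Ψ Q ]ₛ) [ lapp t stoup ]ₛ)
        ≈⟨ hlam-cong (≈-st-l (Ψ⁻Ψ Q) _) ⟩
      hlam (lapp t stoup)
        ≈⟨ hlam-η t ⟩
      t ∎

  φφ⁻ (vcon n) t = ≈-refl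
  φφ⁻ one t = ≈-refl
  φφ⁻ (A ×ᵥ B) t = ≈-trans
      (pair-cong (≈-trans (φ-cong A (fst-β _ _)) (φφ⁻ A (fst t))) (≈-trans (φ-cong B (snd-β _ _)) (φφ⁻ B (snd t)))) (pair-η t)
  φφ⁻ (A →ᵥ B) t = ≈-trans (lam-cong (begin
      φ B (app (wk (lam (φ⁻ B (app (wk t) (φ A (var here)))))) (φ⁻ A (var here)))
        ≈⟨ φ-cong B (app-wk-lam _ _) ⟩
      φ B (sub (replace₀ (φ⁻ A (var here))) (φ⁻ B (app (wk t) (φ A (var here)))))
        ≡⟨ cong (φ B) (trans (φ⁻-sub B _ _) (cong (φ⁻ B) (cong₂ app (replace₀-wk t _) (φ-sub A _ (var here))))) ⟩
      φ B (φ⁻ B (app (wk t) (φ A (φ⁻ A (var here)))))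
        ≈⟨ φφ⁻ B _ ⟩
      app (wk t) (φ A (φ⁻ A (var here)))
        ≈⟨ app-cong ≈-refl (φφ⁻ A (var here)) ⟩
      app (wk t) (var here) ∎)) (lam-η t)
  φφ⁻ ⌜ P ⌝ t = begin
      hlam (letTop κ⁻ (Ψ P [ Ψ⁻ P [ lapp t top° ]ₛ ]ₛ))
        ≡˘⟨ cong (λ x → hlam (letTop κ⁻ x)) (st-assoc (Ψ P) (Ψ⁻ P) (lapp t top°)) ⟩
      hlam (letTop κ⁻ ((Ψ P [ Ψ⁻ P ]ₛ) [ lapp t top° ]ₛ))
        ≈⟨ hlam-cong (letTop-cong ≈-refl (≈-st-l (ΨΨ⁻ P) _)) ⟩
      hlam (letTop κ⁻ (lapp t κ [ top ]ₛ))
        ≈⟨ hlam-cong (letTop-η κ⁻ (lapp t κ)) ⟩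
      hlam (lapp t (κ [ κ⁻ ]ₛ))
        ≡⟨ cong (λ x → hlam (lapp t x)) κ-κ⁻ ⟩
      hlam (lapp t stoup)
        ≈⟨ hlam-η t ⟩
      t ∎
  φφ⁻ (P ⊸ Q) t = begin
      hlam (Ψ Q [ lapp (hlam (Ψ⁻ Q [ lapp t (Ψ P) ]ₛ)) (Ψ⁻ P) ]ₛ)
        ≈⟨ hlam-cong (≈-st-r (Ψ Q) (hlam-β _ _)) ⟩
      hlam (Ψ Q [ (Ψ⁻ Q [ lapp t (Ψ P) ]ₛ) [ Ψ⁻ P ]ₛ ]ₛ)
        ≡⟨ cong (λ x → hlam (Ψ Q [ x ]ₛ)) (st-assoc (Ψ⁻ Q) (lapp t (Ψ P)) (Ψ⁻ P)) ⟩
      hlam (Ψ Q [ Ψ⁻ Q [ lapp t (Ψ P [ Ψ⁻ P ]ₛ) ]ₛ ]ₛ)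
        ≈⟨ hlam-cong (≈-st-r (Ψ Q) (≈-st-r (Ψ⁻ Q) (lapp-cong ≈-refl (ΨΨ⁻ P)))) ⟩
      hlam (Ψ Q [ Ψ⁻ Q [ lapp t stoup ]ₛ ]ₛ)
        ≡˘⟨ cong hlam (st-assoc (Ψ Q) (Ψ⁻ Q) (lapp t stoup)) ⟩
      hlam ((Ψ Q [ Ψ⁻ Q ]ₛ) [ lapp t stoup ]ₛ)
        ≈⟨ hlam-cong (≈-st-l (ΨΨ⁻ Q) _) ⟩
      hlam (lapp t stoup)
        ≈⟨ hlam-η t ⟩
      t ∎

  &-iso : ∀ {Γ P₁ P₂ Q₁ Q₂} (a : Tm Γ (just P₂) ⌜ P₁ ⌝) (a' : Tm Γ (just P₁) ⌜ P₂ ⌝) (b : Tm Γ (just Q₂) ⌜ Q₁ ⌝) (b' : Tm Γ (just Q₁) ⌜ Q₂ ⌝) →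
    a [ a' ]ₛ ≈ stoup → b [ b' ]ₛ ≈ stoup →
    cpair (a [ cfst stoup ]ₛ) (b [ csnd stoup ]ₛ) [ cpair (a' [ cfst stoup ]ₛ) (b' [ csnd stoup ]ₛ) ]ₛ ≈ stoup
  &-iso a a' b b' p q = ≈-trans (cpair-cong
     (begin
       (a [ cfst stoup ]ₛ) [ cpair (a' [ cfst stoup ]ₛ) (b' [ csnd stoup ]ₛ) ]ₛ
         ≡⟨ st-assoc a (cfst stoup) _ ⟩
       a [ cfst (cpair (a' [ cfst stoup ]ₛ) (b' [ csnd stoup ]ₛ)) ]ₛ
         ≈⟨ ≈-st-r a (cfst-β _ _) ⟩
       a [ a' [ cfst stoup ]ₛ ]ₛ
         ≡˘⟨ st-assoc a a' (cfst stoup) ⟩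
       (a [ a' ]ₛ) [ cfst stoup ]ₛ
         ≈⟨ ≈-st-l p (cfst stoup) ⟩
       cfst stoup ∎)
     (begin
       (b [ csnd stoup ]ₛ) [ cpair (a' [ cfst stoup ]ₛ) (b' [ csnd stoup ]ₛ) ]ₛ
         ≡⟨ st-assoc b (csnd stoup) _ ⟩
       b [ csnd (cpair (a' [ cfst stoup ]ₛ) (b' [ csnd stoup ]ₛ)) ]ₛ
         ≈⟨ ≈-st-r b (csnd-β _ _) ⟩
       b [ b' [ csnd stoup ]ₛ ]ₛ
         ≡˘⟨ st-assoc b b' (csnd stoup) ⟩
       (b [ b' ]ₛ) [ csnd stoup ]ₛ
         ≈⟨ ≈-st-l q (csnd stoup) ⟩
       csnd stoup ∎))
    (cpair-η stoup)

  ⊕-iso : ∀ {Γ P₁ P₂ Q₁ Q₂} (a : Tm Γ (just P₂) ⌜ P₁ ⌝) (a' : Tm Γ (just P₁) ⌜ P₂ ⌝) (b : Tm Γ (just Q₂) ⌜ Q₁ ⌝) (b' : Tm Γ (just Q₁) ⌜ Q₂ ⌝) →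
    a [ a' ]ₛ ≈ stoup → b [ b' ]ₛ ≈ stoup →
    case stoup (inl a) (inr b) [ case stoup (inl a') (inr b') ]ₛ ≈ stoup
  ⊕-iso a a' b b' p q = ≈-trans (CC-case (case stoup (inl a) (inr b)) stoup (inl a') (inr b'))
    (≈-trans (case-cong ≈-refl (≈-trans (case-βl _ _ _) (inl-cong p)) (≈-trans (case-βr _ _ _) (inr-cong q)))
      (case-η stoup stoup))

  Ψ⁻Ψ (ccon m) = ≡→≈ (castˢ-inv (ccon°° m))
  Ψ⁻Ψ One = ≈-refl
  Ψ⁻Ψ (P & Q) = &-iso (Ψ⁻ P) (Ψ P) (Ψ⁻ Q) (Ψ Q) (Ψ⁻Ψ P) (Ψ⁻Ψ Q)
  Ψ⁻Ψ (A ⇒ Q) = ≈-trans (clam-cong (begin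
      (Ψ⁻ Q [ capp stoup (φ A (var here)) ]ₛ) [ wk (Ψ (A ⇒ Q)) ]ₛ
        ≡⟨ st-assoc (Ψ⁻ Q) _ _ ⟩
      Ψ⁻ Q [ capp (wk (Ψ (A ⇒ Q))) (φ A (var here)) ]ₛ
        ≈⟨ ≈-st-r (Ψ⁻ Q) (capp-wk-clam _ _) ⟩
      Ψ⁻ Q [ sub (replace₀ (φ A (var here))) (Ψ Q [ capp stoup (φ⁻ A (var here)) ]ₛ) ]ₛ
        ≡⟨ cong (Ψ⁻ Q [_]ₛ)
            (trans (sub-st-with (Ψ Q) (capp stoup (φ⁻ A (var here))) (Ψ-sub Q _)) (cong (λ x → Ψ Q [ capp stoup x ]ₛ) (φ⁻-sub A _ (var here)))) ⟩
      Ψ⁻ Q [ Ψ Q [ capp stoup (φ⁻ A (φ A (var here))) ]ₛ ]ₛ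
        ≈⟨ ≈-st-r (Ψ⁻ Q) (≈-st-r (Ψ Q) (capp-cong ≈-refl (φ⁻φ A (var here)))) ⟩
      Ψ⁻ Q [ Ψ Q [ capp stoup (var here) ]ₛ ]ₛ
        ≡˘⟨ st-assoc (Ψ⁻ Q) (Ψ Q) _ ⟩
      (Ψ⁻ Q [ Ψ Q ]ₛ) [ capp stoup (var here) ]ₛ
        ≈⟨ ≈-st-l (Ψ⁻Ψ Q) _ ⟩
      capp stoup (var here) ∎)) (clam-η stoup)
  Ψ⁻Ψ I = ≡→≈ κ⁻-κ
  Ψ⁻Ψ (! A) = begin
      letTens (letBang stoup (tens (φ A (var here)) top°)) (letTop κ⁻ (bang (φ⁻ A (var here))))
        ≈⟨ CC-letBang (letTens stoup (letTop κ⁻ (bang (φ⁻ A (var here))))) stoup (tens (φ A (var here)) top°) ⟩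
      letBang stoup (letTens (tens (φ A (var here)) top°) (ren (extR there) (letTop κ⁻ (bang (φ⁻ A (var here))))))
        ≈⟨ letBang-cong ≈-refl (letTens-β _ _ _) ⟩
      letBang stoup ((ren (extR there) (letTop κ⁻ (bang (φ⁻ A (var here)))) [ φ A (var here) ]) [ top° ]ₛ)
        ≡⟨ cong (λ x → letBang stoup (x [ top° ]ₛ))
            (trans (ren-single-replace₀ (letTop κ⁻ (bang (φ⁻ A (var here)))) (φ A (var here))) (cong₂ (λ a b → letTop a (bang b)) (castˢ-sub (replace₀ (φ A (var here))) R°≡I) (φ⁻-sub A (replace₀ (φ A (var here))) (var here)))) ⟩
      letBang stoup (letTop (κ⁻ [ top° ]ₛ) (bang (φ⁻ A (φ A (var here)))))
        ≡⟨ cong (λ x → letBang stoup (letTop x (bang (φ⁻ A (φ A (var here)))))) κ⁻-top° ⟩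
      letBang stoup (letTop top (bang (φ⁻ A (φ A (var here)))))
        ≈⟨ letBang-cong ≈-refl (≈-trans (letTop-β _) (bang-cong (φ⁻φ A (var here)))) ⟩
      letBang stoup (bang (var here))
        ≈⟨ letBang-η stoup stoup ⟩
      stoup ∎
  Ψ⁻Ψ (! A ⊗ Q) = begin
      letTens (letTens stoup (tens (φ A (var here)) (Ψ Q))) (tens (φ⁻ A (var here)) (Ψ⁻ Q))
        ≈⟨ CC-letTens (letTens stoup (tens (φ⁻ A (var here)) (Ψ⁻ Q))) stoup (tens (φ A (var here)) (Ψ Q)) ⟩
      letTens stoup (letTens (tens (φ A (var here)) (Ψ Q)) (ren (extR there) (tens (φ⁻ A (var here)) (Ψ⁻ Q))))
        ≈⟨ letTens-cong ≈-refl (letTens-β _ _ _) ⟩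
      letTens stoup ((ren (extR there) (tens (φ⁻ A (var here)) (Ψ⁻ Q)) [ φ A (var here) ]) [ Ψ Q ]ₛ)
        ≡⟨ cong (λ x → letTens stoup (x [ Ψ Q ]ₛ))
            (trans (ren-single-replace₀ (tens (φ⁻ A (var here)) (Ψ⁻ Q)) (φ A (var here))) (cong₂ tens (φ⁻-sub A (replace₀ (φ A (var here))) (var here)) (Ψ⁻-sub Q (replace₀ (φ A (var here)))))) ⟩
      letTens stoup (tens (φ⁻ A (φ A (var here))) (Ψ⁻ Q [ Ψ Q ]ₛ))
        ≈⟨ letTens-cong ≈-refl (tens-cong (φ⁻φ A (var here)) (Ψ⁻Ψ Q)) ⟩
      letTens stoup (tens (var here) stoup)
        ≈⟨ letTens-η stoup stoup ⟩
      stoup ∎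
  Ψ⁻Ψ Zero = ≈-refl
  Ψ⁻Ψ (P ⊕ Q) = ⊕-iso (Ψ⁻ P) (Ψ P) (Ψ⁻ Q) (Ψ Q) (Ψ⁻Ψ P) (Ψ⁻Ψ Q)

  ΨΨ⁻ (ccon m) = ≡→≈ (castˢ-inv' (ccon°° m))
  ΨΨ⁻ One = ≈-refl
  ΨΨ⁻ (P & Q) = &-iso (Ψ P) (Ψ⁻ P) (Ψ Q) (Ψ⁻ Q) (ΨΨ⁻ P) (ΨΨ⁻ Q)
  ΨΨ⁻ (A ⇒ Q) = ≈-trans (clam-cong (begin
      (Ψ Q [ capp stoup (φ⁻ A (var here)) ]ₛ) [ wk (Ψ⁻ (A ⇒ Q)) ]ₛ
        ≡⟨ st-assoc (Ψ Q) _ _ ⟩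
      Ψ Q [ capp (wk (Ψ⁻ (A ⇒ Q))) (φ⁻ A (var here)) ]ₛ
        ≈⟨ ≈-st-r (Ψ Q) (capp-wk-clam _ _) ⟩
      Ψ Q [ sub (replace₀ (φ⁻ A (var here))) (Ψ⁻ Q [ capp stoup (φ A (var here)) ]ₛ) ]ₛ
        ≡⟨ cong (Ψ Q [_]ₛ)
            (trans (sub-st-with (Ψ⁻ Q) (capp stoup (φ A (var here))) (Ψ⁻-sub Q _)) (cong (λ x → Ψ⁻ Q [ capp stoup x ]ₛ) (φ-sub A _ (var here)))) ⟩
      Ψ Q [ Ψ⁻ Q [ capp stoup (φ A (φ⁻ A (var here))) ]ₛ ]ₛ
        ≈⟨ ≈-st-r (Ψ Q) (≈-st-r (Ψ⁻ Q) (capp-cong ≈-refl (φφ⁻ A (var here)))) ⟩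
      Ψ Q [ Ψ⁻ Q [ capp stoup (var here) ]ₛ ]ₛ
        ≡˘⟨ st-assoc (Ψ Q) (Ψ⁻ Q) _ ⟩
      (Ψ Q [ Ψ⁻ Q ]ₛ) [ capp stoup (var here) ]ₛ
        ≈⟨ ≈-st-l (ΨΨ⁻ Q) _ ⟩
      capp stoup (var here) ∎)) (clam-η stoup)
  ΨΨ⁻ I = ≡→≈ κ-κ⁻
  ΨΨ⁻ (! A) = begin
      letBang (letTens stoup (letTop κ⁻ (bang (φ⁻ A (var here))))) (tens (φ A (var here)) top°)
        ≈⟨ CC-letTens (letBang stoup (tens (φ A (var here)) top°)) stoup (letTop κ⁻ (bang (φ⁻ A (var here)))) ⟩
      letTens stoup (letBang (letTop κ⁻ (bang (φ⁻ A (var here)))) (ren (extR there) (tens (φ A (var here)) top°)))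
        ≈⟨ letTens-cong ≈-refl (CC-letTop (letBang stoup (ren (extR there) (tens (φ A (var here)) top°))) κ⁻ (bang (φ⁻ A (var here)))) ⟩
      letTens stoup (letTop κ⁻ (letBang (bang (φ⁻ A (var here))) (ren (extR there) (tens (φ A (var here)) top°))))
        ≈⟨ letTens-cong ≈-refl (letTop-cong ≈-refl (letBang-β _ _)) ⟩
      letTens stoup (letTop κ⁻ (ren (extR there) (tens (φ A (var here)) top°) [ φ⁻ A (var here) ]))
        ≡⟨ cong (λ x → letTens stoup (letTop κ⁻ x))
            (trans (ren-single-replace₀ (tens (φ A (var here)) top°) (φ⁻ A (var here))) (cong₂ tens (φ-sub A (replace₀ (φ⁻ A (var here))) (var here)) (top°-sub (replace₀ (φ⁻ A (var here)))))) ⟩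
      letTens stoup (letTop κ⁻ (tens (φ A (φ⁻ A (var here))) top°))
        ≈⟨ letTens-cong ≈-refl (letTop-cong ≈-refl (tens-cong (φφ⁻ A (var here)) ≈-refl)) ⟩
      letTens stoup (letTop κ⁻ (tens (var here) κ [ top ]ₛ))
        ≈⟨ letTens-cong ≈-refl (letTop-η κ⁻ (tens (var here) κ)) ⟩
      letTens stoup (tens (var here) (κ [ κ⁻ ]ₛ))
        ≡⟨ cong (λ x → letTens stoup (tens (var here) x)) κ-κ⁻ ⟩
      letTens stoup (tens (var here) stoup)
        ≈⟨ letTens-η stoup stoup ⟩
      stoup ∎
  ΨΨ⁻ (! A ⊗ Q) = begin
      letTens (letTens stoup (tens (φ⁻ A (var here)) (Ψ⁻ Q))) (tens (φ A (var here)) (Ψ Q))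
        ≈⟨ CC-letTens (letTens stoup (tens (φ A (var here)) (Ψ Q))) stoup (tens (φ⁻ A (var here)) (Ψ⁻ Q)) ⟩
      letTens stoup (letTens (tens (φ⁻ A (var here)) (Ψ⁻ Q)) (ren (extR there) (tens (φ A (var here)) (Ψ Q))))
        ≈⟨ letTens-cong ≈-refl (letTens-β _ _ _) ⟩
      letTens stoup ((ren (extR there) (tens (φ A (var here)) (Ψ Q)) [ φ⁻ A (var here) ]) [ Ψ⁻ Q ]ₛ)
        ≡⟨ cong (λ x → letTens stoup (x [ Ψ⁻ Q ]ₛ))
            (trans (ren-single-replace₀ (tens (φ A (var here)) (Ψ Q)) (φ⁻ A (var here))) (cong₂ tens (φ-sub A (replace₀ (φ⁻ A (var here))) (var here)) (Ψ-sub Q (replace₀ (φ⁻ A (var here)))))) ⟩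
      letTens stoup (tens (φ A (φ⁻ A (var here))) (Ψ Q [ Ψ⁻ Q ]ₛ))
        ≈⟨ letTens-cong ≈-refl (tens-cong (φφ⁻ A (var here)) (ΨΨ⁻ Q)) ⟩
      letTens stoup (tens (var here) stoup)
        ≈⟨ letTens-η stoup stoup ⟩
      stoup ∎
  ΨΨ⁻ Zero = ≈-refl
  ΨΨ⁻ (P ⊕ Q) = ⊕-iso (Ψ P) (Ψ⁻ P) (Ψ Q) (Ψ⁻ Q) (ΨΨ⁻ P) (ΨΨ⁻ Q)


  -- Naturality of Ψ: for each constructor, if the translated-twice arguments are Ψ
  -- applied to some source terms, then so is the translated-twice result.  These
  -- are the inductive steps of the double-translation lemma.
  Ψ-cpair : ∀ {G Δ P Q} {a : Tm G Δ ⌜ P ° ° ⌝} {b : Tm G Δ ⌜ Q ° ° ⌝} (A : Tm G Δ ⌜ P ⌝) (B : Tm G Δ ⌜ Q ⌝) →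
    a ≈ Ψ P [ A ]ₛ → b ≈ Ψ Q [ B ]ₛ → cpair a b ≈ Ψ (P & Q) [ cpair A B ]ₛ
  Ψ-cpair {P = P} {Q} A B p q = ≈-trans (cpair-cong p q) (≈-sym (cpair-cong
    (≈-trans (≡→≈ (st-assoc (Ψ P) (cfst stoup) (cpair A B))) (≈-st-r (Ψ P) (cfst-β A B)))
    (≈-trans (≡→≈ (st-assoc (Ψ Q) (csnd stoup) (cpair A B))) (≈-st-r (Ψ Q) (csnd-β A B)))))

  Ψ-cfst : ∀ {G Δ P Q} {a : Tm G Δ ⌜ (P & Q) ° ° ⌝} (A : Tm G Δ ⌜ P & Q ⌝) → a ≈ Ψ (P & Q) [ A ]ₛ → cfst a ≈ Ψ P [ cfst A ]ₛ
  Ψ-cfst {P = P} A p = ≈-trans (cfst-cong p) (≈-trans (cfst-β _ _) (≡→≈ (st-assoc (Ψ P) (cfst stoup) A)))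

  Ψ-csnd : ∀ {G Δ P Q} {a : Tm G Δ ⌜ (P & Q) ° ° ⌝} (A : Tm G Δ ⌜ P & Q ⌝) → a ≈ Ψ (P & Q) [ A ]ₛ → csnd a ≈ Ψ Q [ csnd A ]ₛ
  Ψ-csnd {Q = Q} A p = ≈-trans (csnd-cong p) (≈-trans (csnd-β _ _) (≡→≈ (st-assoc (Ψ Q) (csnd stoup) A)))

  Ψ-clam : ∀ {G Δ A Q} {m : Tm ((A • •) ∷ G) Δ ⌜ Q ° ° ⌝} (T : Tm (A ∷ G) Δ ⌜ Q ⌝) →
    m ≈ Ψ Q [ sub (replace₀ (φ⁻ A (var here))) T ]ₛ → clam m ≈ Ψ (A ⇒ Q) [ clam T ]ₛ
  Ψ-clam {A = A} {Q} T p = ≈-trans (clam-cong p) (≈-sym (clam-cong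
    (≈-trans (≡→≈ (st-assoc (Ψ Q) (capp stoup (φ⁻ A (var here))) (wk (clam T)))) (≈-st-r (Ψ Q) (capp-wk-clam T _)))))

  Ψ-capp : ∀ {G Δ A Q} {a : Tm G Δ ⌜ (A ⇒ Q) ° ° ⌝} {u : Tm G nothing (A • •)} (S : Tm G Δ ⌜ A ⇒ Q ⌝) (U : Tm G nothing A) →
    a ≈ Ψ (A ⇒ Q) [ S ]ₛ → u ≈ φ A U → capp a u ≈ Ψ Q [ capp S U ]ₛ
  Ψ-capp {A = A} {Q} S U p q = begin
      capp _ _
        ≈⟨ capp-cong p q ⟩
      capp (clam ((Ψ Q [ capp stoup (φ⁻ A (var here)) ]ₛ) [ wk S ]ₛ)) (φ A U)
        ≈⟨ clam-β _ _ ⟩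
      sub (single (φ A U)) ((Ψ Q [ capp stoup (φ⁻ A (var here)) ]ₛ) [ wk S ]ₛ)
        ≡⟨ trans (sub-st (single (φ A U)) (Ψ Q [ capp stoup (φ⁻ A (var here)) ]ₛ) (wk S))
             (cong₂ _[_]ₛ (trans (sub-st-with (Ψ Q) (capp stoup (φ⁻ A (var here))) (Ψ-sub Q _)) (cong (λ x → Ψ Q [ capp stoup x ]ₛ) (φ⁻-sub A _ (var here)))) (wk-single S _)) ⟩
      (Ψ Q [ capp stoup (φ⁻ A (φ A U)) ]ₛ) [ S ]ₛ
        ≡⟨ st-assoc (Ψ Q) _ S ⟩
      Ψ Q [ capp S (φ⁻ A (φ A U)) ]ₛ
        ≈⟨ ≈-st-r (Ψ Q) (capp-cong ≈-refl (φ⁻φ A U)) ⟩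
      Ψ Q [ capp S U ]ₛ ∎

  Ψ-letTop : ∀ {G Δ P} {a : Tm G Δ ⌜ R ° ⌝} {u : Tm G nothing (⌜ P ⌝ • •)} (A : Tm G Δ ⌜ I ⌝) (U : Tm G nothing ⌜ P ⌝) →
    a ≈ κ [ A ]ₛ → lapp u top° ≈ Ψ P [ U ]ₛ → lapp u a ≈ Ψ P [ letTop A U ]ₛ
  Ψ-letTop {P = P} {u = u} A U p q = begin
      lapp u _
        ≈⟨ lapp-cong ≈-refl p ⟩
      lapp u κ [ A ]ₛ
        ≈⟨ ≈-sym (letTop-η A (lapp u κ)) ⟩
      letTop A (lapp u top°)
        ≈⟨ letTop-cong ≈-refl q ⟩
      letTop A (Ψ P [ U ]ₛ)
        ≈⟨ ≈-sym (CC-letTop (Ψ P) A U) ⟩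
      Ψ P [ letTop A U ]ₛ ∎

  Ψ-bang : ∀ {G A} {t : Tm G nothing (A • •)} (T : Tm G nothing A) → t ≈ φ A T → tens t top° ≈ Ψ (! A) [ bang T ]ₛ
  Ψ-bang {A = A} T p = ≈-trans (tens-cong p ≈-refl) (≈-sym (≈-trans (letBang-β _ _)
    (≡→≈ (cong₂ tens (φ-sub A _ (var here)) (top°-sub _)))))

  Ψ-tens : ∀ {G Δ A Q} {t : Tm G nothing (A • •)} {b : Tm G Δ ⌜ Q ° ° ⌝} (T : Tm G nothing A) (B : Tm G Δ ⌜ Q ⌝) →
    t ≈ φ A T → b ≈ Ψ Q [ B ]ₛ → tens t b ≈ Ψ (! A ⊗ Q) [ tens T B ]ₛ
  Ψ-tens {A = A} {Q} T B p q = ≈-trans (tens-cong p q) (≈-sym (≈-trans (letTens-β _ _ _)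
    (≡→≈ (cong₂ tens (φ-sub A _ (var here)) (cong (_[ B ]ₛ) (Ψ-sub Q _))))))

  Ψ-abort : ∀ {G Δ P} {a : Tm G Δ ⌜ Zero ⌝} (A : Tm G Δ ⌜ Zero ⌝) → a ≈ A → abort a ≈ Ψ P [ abort A ]ₛ
  Ψ-abort {P = P} A p = ≈-trans (abort-cong p) (≈-sym (CC-abort (Ψ P) A))

  Ψ-inl : ∀ {G Δ P Q} {a : Tm G Δ ⌜ P ° ° ⌝} (A : Tm G Δ ⌜ P ⌝) → a ≈ Ψ P [ A ]ₛ → inl a ≈ Ψ (P ⊕ Q) [ inl A ]ₛ
  Ψ-inl A p = ≈-trans (inl-cong p) (≈-sym (case-βl _ _ _))

  Ψ-inr : ∀ {G Δ P Q} {a : Tm G Δ ⌜ Q ° ° ⌝} (A : Tm G Δ ⌜ Q ⌝) → a ≈ Ψ Q [ A ]ₛ → inr a ≈ Ψ (P ⊕ Q) [ inr A ]ₛ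
  Ψ-inr A p = ≈-trans (inr-cong p) (≈-sym (case-βr _ _ _))

  Ψ-lapp : ∀ {G Δ P Q} {s : Tm G nothing ((P ⊸ Q) • •)} {a : Tm G Δ ⌜ P ° ° ⌝} (S : Tm G nothing (P ⊸ Q)) (A : Tm G Δ ⌜ P ⌝) →
    s ≈ φ (P ⊸ Q) S → a ≈ Ψ P [ A ]ₛ → lapp s a ≈ Ψ Q [ lapp S A ]ₛ
  Ψ-lapp {P = P} {Q} S A p q = begin
      lapp _ _
        ≈⟨ lapp-cong p q ⟩
      lapp (hlam (Ψ Q [ lapp S (Ψ⁻ P) ]ₛ)) (Ψ P [ A ]ₛ)
        ≈⟨ hlam-β _ _ ⟩
      (Ψ Q [ lapp S (Ψ⁻ P) ]ₛ) [ Ψ P [ A ]ₛ ]ₛ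
        ≡⟨ st-assoc (Ψ Q) _ _ ⟩
      Ψ Q [ lapp S (Ψ⁻ P [ Ψ P [ A ]ₛ ]ₛ) ]ₛ
        ≡˘⟨ cong (λ x → Ψ Q [ lapp S x ]ₛ) (st-assoc (Ψ⁻ P) (Ψ P) A) ⟩
      Ψ Q [ lapp S ((Ψ⁻ P [ Ψ P ]ₛ) [ A ]ₛ) ]ₛ
        ≈⟨ ≈-st-r (Ψ Q) (lapp-cong ≈-refl (≈-st-l (Ψ⁻Ψ P) A)) ⟩
      Ψ Q [ lapp S A ]ₛ ∎

  Ψ-transport : ∀ {G C X Y} {x : Tm G (just Y) ⌜ C ° ° ⌝} (T : Tm G (just X) ⌜ C ⌝) (f : Tm G (just X) ⌜ Y ⌝) (g : Tm G (just Y) ⌜ X ⌝) → g [ f ]ₛ ≈ stoup →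
    x ≈ Ψ C [ T [ g ]ₛ ]ₛ → x [ f ]ₛ ≈ Ψ C [ T ]ₛ
  Ψ-transport {C = C} T f g gf h = begin
      _ [ f ]ₛ
        ≈⟨ ≈-st-l h f ⟩
      (Ψ C [ T [ g ]ₛ ]ₛ) [ f ]ₛ
        ≡⟨ st-assoc (Ψ C) _ f ⟩
      Ψ C [ (T [ g ]ₛ) [ f ]ₛ ]ₛ
        ≡⟨ cong (Ψ C [_]ₛ) (st-assoc T g f) ⟩
      Ψ C [ T [ g [ f ]ₛ ]ₛ ]ₛ
        ≈⟨ ≈-st-r (Ψ C) (≈-st-r T gf) ⟩
      Ψ C [ T [ stoup ]ₛ ]ₛ
        ≡⟨ cong (Ψ C [_]ₛ) (st-id T) ⟩
      Ψ C [ T ]ₛ ∎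

  Ψ-case : ∀ {G Δ P Q C} {a : Tm G Δ ⌜ (P ⊕ Q) ° ° ⌝} {t : Tm G (just (P ° °)) ⌜ C ° ° ⌝} {u : Tm G (just (Q ° °)) ⌜ C ° ° ⌝}
    (S : Tm G Δ ⌜ P ⊕ Q ⌝) (T : Tm G (just P) ⌜ C ⌝) (U : Tm G (just Q) ⌜ C ⌝) →
    a ≈ Ψ (P ⊕ Q) [ S ]ₛ → t ≈ Ψ C [ T [ Ψ⁻ P ]ₛ ]ₛ → u ≈ Ψ C [ U [ Ψ⁻ Q ]ₛ ]ₛ → case a t u ≈ Ψ C [ case S T U ]ₛ
  Ψ-case {P = P} {Q} {C} {t = t} {u} S T U p q r = begin
      case _ t u
        ≈⟨ case-cong p ≈-refl ≈-refl ⟩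
      case stoup t u [ case S (inl (Ψ P)) (inr (Ψ Q)) ]ₛ
        ≈⟨ CC-case (case stoup t u) S (inl (Ψ P)) (inr (Ψ Q)) ⟩
      case S (case (inl (Ψ P)) t u) (case (inr (Ψ Q)) t u)
        ≈⟨ case-cong ≈-refl (≈-trans (case-βl _ _ _) (Ψ-transport T (Ψ P) (Ψ⁻ P) (Ψ⁻Ψ P) q))
            (≈-trans (case-βr _ _ _) (Ψ-transport U (Ψ Q) (Ψ⁻ Q) (Ψ⁻Ψ Q) r)) ⟩
      case S (Ψ C [ T ]ₛ) (Ψ C [ U ]ₛ)
        ≈⟨ ≈-sym (CC-case (Ψ C) S T U) ⟩
      Ψ C [ case S T U ]ₛ ∎

  Ψ-letBang : ∀ {G Δ A Q} {a : Tm G Δ ⌜ (! A) ° ° ⌝} {u : Tm ((A • •) ∷ G) nothing (⌜ Q ⌝ • •)} (A' : Tm G Δ ⌜ ! A ⌝) (U : Tm (A ∷ G) nothing ⌜ Q ⌝) →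
    a ≈ Ψ (! A) [ A' ]ₛ → lapp (sub (replace₀ (φ A (var here))) u) top° ≈ Ψ Q [ U ]ₛ → letTens a (lapp u stoup) ≈ Ψ Q [ letBang A' U ]ₛ
  Ψ-letBang {A = A} {Q} {u = u} A' U p q = begin
      letTens _ (lapp u stoup)
        ≈⟨ letTens-cong p ≈-refl ⟩
      letTens stoup (lapp u stoup) [ letBang A' (tens (φ A (var here)) top°) ]ₛ
        ≈⟨ CC-letBang (letTens stoup (lapp u stoup)) A' (tens (φ A (var here)) top°) ⟩
      letBang A' (letTens (tens (φ A (var here)) top°) (lapp (ren (extR there) u) stoup))
        ≈⟨ letBang-cong ≈-refl (letTens-β _ _ _) ⟩
      letBang A' (lapp (ren (extR there) u [ φ A (var here) ]) top°)
        ≡⟨ cong (λ x → letBang A' (lapp x top°)) (ren-single-replace₀ u (φ A (var here))) ⟩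
      letBang A' (lapp (sub (replace₀ (φ A (var here))) u) top°)
        ≈⟨ letBang-cong ≈-refl q ⟩
      letBang A' (Ψ Q [ U ]ₛ)
        ≡˘⟨ cong (λ x → letBang A' (x [ U ]ₛ)) (Ψ-ren Q there) ⟩
      letBang A' (wk (Ψ Q) [ U ]ₛ)
        ≈⟨ ≈-sym (CC-letBang (Ψ Q) A' U) ⟩
      Ψ Q [ letBang A' U ]ₛ ∎

  Ψ-letTens : ∀ {G Δ A Q S} {a : Tm G Δ ⌜ (! A ⊗ Q) ° ° ⌝} {t : Tm ((A • •) ∷ G) (just (Q ° °)) ⌜ S ° ° ⌝} (S' : Tm G Δ ⌜ ! A ⊗ Q ⌝) (T : Tm (A ∷ G) (just Q) ⌜ S ⌝) →
    a ≈ Ψ (! A ⊗ Q) [ S' ]ₛ → sub (replace₀ (φ A (var here))) t ≈ Ψ S [ T [ Ψ⁻ Q ]ₛ ]ₛ → letTens a t ≈ Ψ S [ letTens S' T ]ₛ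
  Ψ-letTens {A = A} {Q} {S} {t = t} S' T p q = begin
      letTens _ t
        ≈⟨ letTens-cong p ≈-refl ⟩
      letTens stoup t [ letTens S' (tens (φ A (var here)) (Ψ Q)) ]ₛ
        ≈⟨ CC-letTens (letTens stoup t) S' (tens (φ A (var here)) (Ψ Q)) ⟩
      letTens S' (letTens (tens (φ A (var here)) (Ψ Q)) (ren (extR there) t))
        ≈⟨ letTens-cong ≈-refl (letTens-β _ _ _) ⟩
      letTens S' ((ren (extR there) t [ φ A (var here) ]) [ Ψ Q ]ₛ)
        ≡⟨ cong (λ x → letTens S' (x [ Ψ Q ]ₛ)) (ren-single-replace₀ t (φ A (var here))) ⟩
      letTens S' (sub (replace₀ (φ A (var here))) t [ Ψ Q ]ₛ)
        ≈⟨ letTens-cong ≈-refl (Ψ-transport T (Ψ Q) (Ψ⁻ Q) (Ψ⁻Ψ Q) q) ⟩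
      letTens S' (Ψ S [ T ]ₛ)
        ≡˘⟨ cong (λ x → letTens S' (x [ T ]ₛ)) (Ψ-ren S there) ⟩
      letTens S' (wk (Ψ S) [ T ]ₛ)
        ≈⟨ ≈-sym (CC-letTens (Ψ S) S' T) ⟩
      Ψ S [ letTens S' T ]ₛ ∎


  Φ : ∀ {Γ} → Sub Γ ((Γ •c) •c)
  Φ {A = A} x = φ⁻ A (var (varᵗ (varᵗ x)))

  Φ-ext : ∀ {Γ A Δ B} (t : Tm (A ∷ Γ) Δ B) → sub (replace₀ (φ⁻ A (var here))) (sub (extS Φ) t) ≡ sub Φ t
  Φ-ext {Γ} {A} t = sub-sub f t
    where
    f : ∀ {C} (x : (A ∷ Γ) ∋ C) → sub (replace₀ (φ⁻ A (var here))) (extS Φ x) ≡ Φ x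
    f here = refl
    f {C} (there x) = trans (replace₀-wk (Φ x) _) (φ⁻-ren C there (var (varᵗ (varᵗ x))))

  Φ-ext-φ : ∀ {Γ A Δ B} (t : Tm (A ∷ Γ) Δ B) → sub (replace₀ (φ A (var here))) (sub Φ t) ≈ sub (extS Φ) t
  Φ-ext-φ {Γ} {A} t = ≈-trans (≡→≈ (sub-sub (λ _ → refl) t)) (sub-≈ g t)
    where
    g : ∀ {C} (x : (A ∷ Γ) ∋ C) → sub (replace₀ (φ A (var here))) (Φ x) ≈ extS Φ x
    g here = ≈-trans (≡→≈ (φ⁻-sub A _ (var here))) (φ⁻φ A (var here))
    g {C} (there x) = ≡→≈ (trans (φ⁻-sub C _ _) (sym (φ⁻-ren C there (var (varᵗ (varᵗ x))))))

  -- For computation types, φ ⌜ P ⌝ x is determined by x applied to top°.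
  apply-top° : ∀ {G P} {x : Tm G nothing (⌜ P ⌝ • •)} {T : Tm G nothing ⌜ P ⌝} → x ≈ φ ⌜ P ⌝ T → lapp x top° ≈ Ψ P [ T ]ₛ
  apply-top° {P = P} {T = T} p = begin
      lapp _ top°
        ≈⟨ lapp-cong p ≈-refl ⟩
      lapp (hlam (letTop κ⁻ (Ψ P [ T ]ₛ))) top°
        ≈⟨ hlam-β _ _ ⟩
      letTop (κ⁻ [ top° ]ₛ) (Ψ P [ T ]ₛ)
        ≡⟨ cong (λ x → letTop x (Ψ P [ T ]ₛ)) κ⁻-top° ⟩
      letTop top (Ψ P [ T ]ₛ)
        ≈⟨ letTop-β _ ⟩
      Ψ P [ T ]ₛ ∎

  from-apply-top° : ∀ {G P} {x : Tm G nothing (⌜ P ⌝ • •)} {T : Tm G nothing ⌜ P ⌝} → lapp x top° ≈ Ψ P [ T ]ₛ → x ≈ φ ⌜ P ⌝ T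
  from-apply-top° {P = P} {x = x} {T = T} p = begin
      x
        ≈⟨ ≈-sym (hlam-η x) ⟩
      hlam (lapp x stoup)
        ≡˘⟨ cong (λ y → hlam (lapp x y)) κ-κ⁻ ⟩
      hlam (lapp x κ [ κ⁻ ]ₛ)
        ≈⟨ ≈-sym (hlam-cong (letTop-η κ⁻ (lapp x κ))) ⟩
      hlam (letTop κ⁻ (lapp x top°))
        ≈⟨ hlam-cong (letTop-cong ≈-refl p) ⟩
      hlam (letTop κ⁻ (Ψ P [ T ]ₛ)) ∎

  -- the form in which the computation-type cases of the key lemma are proved
  via-top° : ∀ {G P} {X : Tm G (just (R °)) ⌜ P ° ° ⌝} {T : Tm G nothing ⌜ P ⌝} →
             X [ top° ]ₛ ≈ Ψ P [ T ]ₛ → hlam X ≈ φ ⌜ P ⌝ T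
  via-top° {P = P} p = from-apply-top° {P = P} (≈-trans (hlam-β _ top°) p)

  sub-apply-top° : ∀ {G G' Q} (σ : Sub G G') {x : Tm G nothing (⌜ Q ⌝ • •)} {U : Tm G nothing ⌜ Q ⌝} →
      lapp x top° ≈ Ψ Q [ U ]ₛ → lapp (sub σ x) top° ≈ Ψ Q [ sub σ U ]ₛ
  sub-apply-top° {Q = Q} σ {U = U} p = cast≈ (cong (lapp _) (top°-sub σ)) (sub-st-with (Ψ Q) U (Ψ-sub Q σ)) (≈-sub σ p)

  sub-Ψ-form : ∀ {G G' Q S} (σ : Sub G G') {x : Tm G (just (Q ° °)) ⌜ S ° ° ⌝} {Y : Tm G (just Q) ⌜ S ⌝} →
      x ≈ Ψ S [ Y [ Ψ⁻ Q ]ₛ ]ₛ → sub σ x ≈ Ψ S [ sub σ Y [ Ψ⁻ Q ]ₛ ]ₛ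
  sub-Ψ-form {Q = Q} {S} σ {Y = Y} p = cast≈ refl
      (trans (sub-st-with (Ψ S) _ (Ψ-sub S σ)) (cong (Ψ S [_]ₛ) (trans (sub-st σ Y (Ψ⁻ Q)) (cong (sub σ Y [_]ₛ) (Ψ⁻-sub Q σ))))) (≈-sub σ p)

  wk-top° : ∀ {G B} → wk {B = B} (top° {G}) ≡ top°
  wk-top° = trans (ren-as-sub there top°) (top°-sub _)

  -- For values of
  -- computation type each case reduces, via via-top°, to a naturality
  -- lemma Ψ-…; stoup terms use °-st to expose the same shape.
  double• : ∀ {Γ A} (t : Tm Γ nothing A) → (t •ᵗ) •ᵗ ≈ φ A (sub Φ t)
  double° : ∀ {Γ D P} (t : Tm Γ (just D) ⌜ P ⌝) → (t °ᵗ) °ᵗ ≈ Ψ P [ (sub Φ t) [ Ψ⁻ D ]ₛ ]ₛ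

  double•ᶜ : ∀ {Γ P} (t : Tm Γ nothing ⌜ P ⌝) → lapp ((t •ᵗ) •ᵗ) top° ≈ Ψ P [ sub Φ t ]ₛ
  double•ᶜ {P = P} t = apply-top° {P = P} (double• t)

  double• {A = A} (var x) = ≈-sym (φφ⁻ A (var (varᵗ (varᵗ x))))
  double• unit = ≈-refl
  double• {A = A ×ᵥ B} (pair t u) = ≈-trans (pair-cong (double• t) (double• u))
      (≈-sym (pair-cong (φ-cong A (fst-β _ _)) (φ-cong B (snd-β _ _))))
  double• (fst t) = ≈-trans (fst-cong (double• t)) (fst-β _ _)
  double• (snd t) = ≈-trans (snd-cong (double• t)) (snd-β _ _)
  double• {A = A →ᵥ B} (lam t) = ≈-trans (lam-cong (double• t)) (≈-sym (lam-cong (φ-cong B (≈-trans (app-wk-lam _ _) (≡→≈ (Φ-ext t))))))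
  double• (app {A = A} {B = B} t u) = begin
      app ((t •ᵗ) •ᵗ) ((u •ᵗ) •ᵗ)
        ≈⟨ app-cong (double• t) (double• u) ⟩
      app (lam (φ B (app (wk (sub Φ t)) (φ⁻ A (var here))))) (φ A (sub Φ u))
        ≈⟨ lam-β _ _ ⟩
      sub (single (φ A (sub Φ u))) (φ B (app (wk (sub Φ t)) (φ⁻ A (var here))))
        ≡⟨ trans (φ-sub B _ _) (cong (φ B) (cong₂ app (wk-single (sub Φ t) _) (φ⁻-sub A _ (var here)))) ⟩
      φ B (app (sub Φ t) (φ⁻ A (φ A (sub Φ u))))
        ≈⟨ φ-cong B (app-cong ≈-refl (φ⁻φ A _)) ⟩
      φ B (app (sub Φ t) (sub Φ u)) ∎
  double• {A = ⌜ PP ⌝} cunit = via-top° {P = PP} ≈-refl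
  double• {A = ⌜ PP ⌝} (cpair t u) = via-top° {P = PP} (Ψ-cpair (sub Φ t) (sub Φ u) (double•ᶜ t) (double•ᶜ u))
  double• {A = ⌜ PP ⌝} (cfst t) = via-top° {P = PP} (Ψ-cfst (sub Φ t) (double•ᶜ t))
  double• {A = ⌜ PP ⌝} (csnd t) = via-top° {P = PP} (Ψ-csnd (sub Φ t) (double•ᶜ t))
  double• {A = ⌜ PP ⌝} (clam {Q = Q} t) = via-top° {P = PP} (Ψ-clam (sub (extS Φ) t)
    (cast≈ (cong (lapp _) (sym wk-top°)) (cong (Ψ Q [_]ₛ) (sym (Φ-ext t))) (double•ᶜ t)))
  double• {A = ⌜ PP ⌝} (capp s u) = via-top° {P = PP} (Ψ-capp (sub Φ s) (sub Φ u) (double•ᶜ s) (double• u))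
  double• {A = ⌜ PP ⌝} top = via-top° {P = PP} ≈-refl
  double• {A = ⌜ PP ⌝} (letTop t u) = via-top° {P = PP} (Ψ-letTop (sub Φ t) (sub Φ u) (double•ᶜ t) (double•ᶜ u))
  double• {A = ⌜ PP ⌝} (bang t) = via-top° {P = PP} (Ψ-bang (sub Φ t) (double• t))
  double• {A = ⌜ PP ⌝} (letBang {A = A} {Q = Q} t u) = via-top° {P = PP} (Ψ-letBang (sub Φ t) (sub (extS Φ) u) (double•ᶜ t)
    (≈-trans (sub-apply-top° {Q = Q} (replace₀ (φ A (var here))) (double•ᶜ u)) (≈-st-r (Ψ Q) (Φ-ext-φ u))))
  double• {A = ⌜ PP ⌝} (tens t u) = via-top° {P = PP} (Ψ-tens (sub Φ t) (sub Φ u) (double• t) (double•ᶜ u))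
  double• {A = ⌜ PP ⌝} (letTens {A = A} {Q = Q} {S = S} s t) = via-top° {P = PP} (Ψ-letTens (sub Φ s) (sub (extS Φ) t) (double•ᶜ s)
    (≈-trans (sub-Ψ-form {Q = Q} {S = S} (replace₀ (φ A (var here))) (double° t)) (≈-st-r (Ψ S) (≈-st-l (Φ-ext-φ t) (Ψ⁻ Q)))))
  double• {A = ⌜ PP ⌝} (abort t) = via-top° {P = PP} (Ψ-abort (sub Φ t) (double•ᶜ t))
  double• {A = ⌜ PP ⌝} (inl t) = via-top° {P = PP} (Ψ-inl (sub Φ t) (double•ᶜ t))
  double• {A = ⌜ PP ⌝} (inr t) = via-top° {P = PP} (Ψ-inr (sub Φ t) (double•ᶜ t))
  double• {A = ⌜ PP ⌝} (case s t u) = via-top° {P = PP} (Ψ-case (sub Φ s) (sub Φ t) (sub Φ u) (double•ᶜ s) (double° t) (double° u))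
  double• (hlam {Q = Q} t) = ≈-trans (hlam-cong (double° t)) (≈-sym (hlam-cong (≈-st-r (Ψ Q) (hlam-β _ _))))
  double• {A = ⌜ PP ⌝} (lapp s t) = via-top° {P = PP} (Ψ-lapp (sub Φ s) (sub Φ t) (double• s) (double•ᶜ t))

  double° {D = D} stoup = ≈-sym (ΨΨ⁻ D)
  double° cunit = ≈-refl
  double° (cpair t u) = Ψ-cpair _ _ (double° t) (double° u)
  double° (cfst t) = ≈-trans (°-st (t °ᵗ) (inl stoup)) (Ψ-cfst _ (double° t))
  double° (csnd t) = ≈-trans (°-st (t °ᵗ) (inr stoup)) (Ψ-csnd _ (double° t))
  double° {D = D} (clam {A = A} {Q = Q} t) = Ψ-clam ((sub (extS Φ) t) [ wk (Ψ⁻ D) ]ₛ)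
    (cast≈ refl (cong (Ψ Q [_]ₛ) (sym (trans (sub-st (replace₀ (φ⁻ A (var here))) (sub (extS Φ) t) (wk (Ψ⁻ D)))
        (cong₂ _[_]ₛ (Φ-ext t) (trans (replace₀-wk (Ψ⁻ D) _) (Ψ⁻-ren D there)))))) (double° t))
  double° (capp s u) = ≈-trans (°-st (s °ᵗ) (tens (u •ᵗ) stoup)) (Ψ-capp _ (sub Φ u) (double° s) (double• u))
  double° (letTop t u) = ≈-trans (°-st (t °ᵗ) (lapp (u •ᵗ) stoup)) (Ψ-letTop _ (sub Φ u) (double° t) (double•ᶜ u))
  double° (letBang {A = A} {Q = Q} t u) = ≈-trans (°-st (t °ᵗ) (clam (lapp (u •ᵗ) stoup))) (Ψ-letBang _ (sub (extS Φ) u) (double° t)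
    (≈-trans (sub-apply-top° {Q = Q} (replace₀ (φ A (var here))) (double•ᶜ u)) (≈-st-r (Ψ Q) (Φ-ext-φ u))))
  double° (tens t u) = ≈-trans (°-st (u °ᵗ) (capp stoup (t •ᵗ))) (Ψ-tens (sub Φ t) _ (double• t) (double° u))
  double° (letTens {A = A} {Q = Q} {S = S} s t) = ≈-trans (°-st (s °ᵗ) (clam (t °ᵗ))) (Ψ-letTens _ (sub (extS Φ) t) (double° s)
    (≈-trans (sub-Ψ-form {Q = Q} {S = S} (replace₀ (φ A (var here))) (double° t)) (≈-st-r (Ψ S) (≈-st-l (Φ-ext-φ t) (Ψ⁻ Q)))))
  double° (abort t) = ≈-trans (°-st (t °ᵗ) cunit) (Ψ-abort _ (double° t))
  double° (inl t) = ≈-trans (°-st (t °ᵗ) (cfst stoup)) (Ψ-inl _ (double° t))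
  double° (inr t) = ≈-trans (°-st (t °ᵗ) (csnd stoup)) (Ψ-inr _ (double° t))
  double° (case s t u) = ≈-trans (°-st (s °ᵗ) (cpair (t °ᵗ) (u °ᵗ))) (Ψ-case _ (sub Φ t) (sub Φ u) (double° s) (double° t) (double° u))
  double° (lapp s t) = ≈-trans (°-st (t °ᵗ) (lapp (s •ᵗ) stoup)) (Ψ-lapp (sub Φ s) _ (double• s) (double° t))

  Φ⁻ : ∀ {Γ} → Sub ((Γ •c) •c) Γ
  Φ⁻ {A ∷ Γ} here = φ A (var here)
  Φ⁻ {A ∷ Γ} (there y) = wk (Φ⁻ y)

  Φ⁻-var : ∀ {Γ A} (x : Γ ∋ A) → Φ⁻ (varᵗ (varᵗ x)) ≡ φ A (var x)
  Φ⁻-var here = refl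
  Φ⁻-var {A = A} (there x) = trans (cong wk (Φ⁻-var x)) (φ-ren A there (var x))

  Φ⁻-Φ : ∀ {Γ Δ A} (t : Tm Γ Δ A) → sub Φ⁻ (sub Φ t) ≈ t
  Φ⁻-Φ t = ≈-trans (≡→≈ (sub-sub (λ _ → refl) t)) (≈-trans (sub-≈ h t) (≡→≈ (sub-id (λ _ → refl) t)))
    where
    h : ∀ {B} (x : _ ∋ B) → sub Φ⁻ (Φ x) ≈ var x
    h {B} x = ≈-trans (≡→≈ (trans (φ⁻-sub B Φ⁻ _) (cong (φ⁻ B) (Φ⁻-var x)))) (φ⁻φ B (var x))

  Φ-there : ∀ {Γ A B} (x : Γ ∋ B) → Φ {A ∷ Γ} (there x) ≡ wk (Φ x)
  Φ-there {B = B} x = sym (φ⁻-ren B there (var (varᵗ (varᵗ x))))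

  Φ-Φ⁻ : ∀ {Γ Δ A} (s : Tm ((Γ •c) •c) Δ A) → sub Φ (sub Φ⁻ s) ≈ s
  Φ-Φ⁻ {Γ} s = ≈-trans (≡→≈ (sub-sub (λ _ → refl) s)) (≈-trans (sub-≈ (h Γ) s) (≡→≈ (sub-id (λ _ → refl) s)))
    where
    h : ∀ Γ {B} (y : ((Γ •c) •c) ∋ B) → sub Φ (Φ⁻ y) ≈ var y
    h (A ∷ Γ) here = ≈-trans (≡→≈ (φ-sub A Φ (var here))) (φφ⁻ A (var here))
    h (A ∷ Γ) (there y) = ≈-trans (≡→≈ (trans (sub-ren (λ x → Φ-there x) (Φ⁻ y)) (sym (ren-sub (λ _ → refl) (Φ⁻ y))))) (≈-wk (h Γ y))

  Φ-reflects : ∀ {Γ Δ A} {t u : Tm Γ Δ A} → sub Φ t ≈ sub Φ u → t ≈ u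
  Φ-reflects {t = t} {u} p = begin
      t                    ≈⟨ ≈-sym (Φ⁻-Φ t) ⟩
      sub Φ⁻ (sub Φ t)     ≈⟨ ≈-sub Φ⁻ p ⟩
      sub Φ⁻ (sub Φ u)     ≈⟨ Φ⁻-Φ u ⟩
      u                    ∎

  faith• : ∀ {Γ A} (t u : Tm Γ nothing A) → t •ᵗ ≈ u •ᵗ → t ≈ u
  faith• {A = A} t u p = Φ-reflects (begin
      sub Φ t                ≈⟨ ≈-sym (φ⁻φ A _) ⟩
      φ⁻ A (φ A (sub Φ t))   ≈⟨ φ⁻-cong A (≈-sym (double• t)) ⟩
      φ⁻ A ((t •ᵗ) •ᵗ)       ≈⟨ φ⁻-cong A (sound• p) ⟩
      φ⁻ A ((u •ᵗ) •ᵗ)       ≈⟨ φ⁻-cong A (double• u) ⟩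
      φ⁻ A (φ A (sub Φ u))   ≈⟨ φ⁻φ A _ ⟩
      sub Φ u                ∎)

  Ψ-unwrap : ∀ {G P Q} (T : Tm G (just P) ⌜ Q ⌝) → Ψ⁻ Q [ (Ψ Q [ T [ Ψ⁻ P ]ₛ ]ₛ) [ Ψ P ]ₛ ]ₛ ≈ T
  Ψ-unwrap {P = P} {Q} T = ≈-trans (≈-st-r (Ψ⁻ Q) (Ψ-transport T (Ψ P) (Ψ⁻ P) (Ψ⁻Ψ P) ≈-refl))
    (≈-trans (≡→≈ (sym (st-assoc (Ψ⁻ Q) (Ψ Q) T))) (≈-st-l (Ψ⁻Ψ Q) T))

  faith° : ∀ {Γ P Q} (t u : Tm Γ (just P) ⌜ Q ⌝) → t °ᵗ ≈ u °ᵗ → t ≈ u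
  faith° {P = P} {Q} t u p = Φ-reflects (begin
      sub Φ t
        ≈⟨ ≈-sym (Ψ-unwrap (sub Φ t)) ⟩
      Ψ⁻ Q [ (Ψ Q [ sub Φ t [ Ψ⁻ P ]ₛ ]ₛ) [ Ψ P ]ₛ ]ₛ
        ≈⟨ under (≈-sym (double° t)) ⟩
      Ψ⁻ Q [ ((t °ᵗ) °ᵗ) [ Ψ P ]ₛ ]ₛ
        ≈⟨ under (sound° p) ⟩
      Ψ⁻ Q [ ((u °ᵗ) °ᵗ) [ Ψ P ]ₛ ]ₛ
        ≈⟨ under (double° u) ⟩
      Ψ⁻ Q [ (Ψ Q [ sub Φ u [ Ψ⁻ P ]ₛ ]ₛ) [ Ψ P ]ₛ ]ₛ
        ≈⟨ Ψ-unwrap (sub Φ u) ⟩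
      sub Φ u ∎)
    where
    under : ∀ {x y} → x ≈ y → Ψ⁻ Q [ x [ Ψ P ]ₛ ]ₛ ≈ Ψ⁻ Q [ y [ Ψ P ]ₛ ]ₛ
    under q = ≈-st-r (Ψ⁻ Q) (≈-st-l q (Ψ P))

  -- Fullness: translate back with φ⁻ (resp. Ψ⁻, Ψ) and Φ⁻; by faithfulness at the
  -- translated types it suffices that the double translations agree.
  full• : ∀ {Γ A} (t : Tm (Γ •c) nothing (A •)) → Σ (Tm Γ nothing A) λ u → t ≈ (u •ᵗ)
  full• {A = A} t = u , ≈-sym (faith• (u •ᵗ) t r)
    where
    u : Tm _ nothing A
    u = φ⁻ A (sub Φ⁻ (t •ᵗ))
    r : (u •ᵗ) •ᵗ ≈ t •ᵗ
    r = ≈-trans (double• u) (≈-trans (≡→≈ (cong (φ A) (φ⁻-sub A Φ _))) (≈-trans (φφ⁻ A _) (Φ-Φ⁻ (t •ᵗ))))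

  full° : ∀ {Γ P Q} (t : Tm (Γ •c) (just (Q °)) ⌜ P ° ⌝) → Σ (Tm Γ (just P) ⌜ Q ⌝) λ u → t ≈ (u °ᵗ)
  full° {P = P} {Q} t = u , ≈-sym (faith° (u °ᵗ) t r)
    where
    SS : Tm ((_ •c) •c) (just (P ° °)) ⌜ Q ° ° ⌝
    SS = sub Φ (sub Φ⁻ (t °ᵗ))
    u : Tm _ (just P) ⌜ Q ⌝
    u = Ψ⁻ Q [ sub Φ⁻ (t °ᵗ) [ Ψ P ]ₛ ]ₛ
    eq : sub Φ u ≡ Ψ⁻ Q [ SS [ Ψ P ]ₛ ]ₛ
    eq = trans (sub-st-with (Ψ⁻ Q) _ (Ψ⁻-sub Q Φ)) (cong (Ψ⁻ Q [_]ₛ) (trans (sub-st Φ (sub Φ⁻ (t °ᵗ)) (Ψ P)) (cong (SS [_]ₛ) (Ψ-sub P Φ))))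
    r : (u °ᵗ) °ᵗ ≈ t °ᵗ
    r = begin
      (u °ᵗ) °ᵗ
        ≈⟨ double° u ⟩
      Ψ Q [ sub Φ u [ Ψ⁻ P ]ₛ ]ₛ
        ≡⟨ cong (λ x → Ψ Q [ x [ Ψ⁻ P ]ₛ ]ₛ) eq ⟩
      Ψ Q [ (Ψ⁻ Q [ SS [ Ψ P ]ₛ ]ₛ) [ Ψ⁻ P ]ₛ ]ₛ
        ≡⟨ cong (Ψ Q [_]ₛ) (trans (st-assoc (Ψ⁻ Q) _ _) (cong (Ψ⁻ Q [_]ₛ) (st-assoc SS (Ψ P) (Ψ⁻ P)))) ⟩
      Ψ Q [ Ψ⁻ Q [ SS [ Ψ P [ Ψ⁻ P ]ₛ ]ₛ ]ₛ ]ₛ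
        ≈⟨ ≈-st-r (Ψ Q) (≈-st-r (Ψ⁻ Q) (≈-st-r SS (ΨΨ⁻ P))) ⟩
      Ψ Q [ Ψ⁻ Q [ SS [ stoup ]ₛ ]ₛ ]ₛ
        ≡⟨ trans (cong (λ x → Ψ Q [ Ψ⁻ Q [ x ]ₛ ]ₛ) (st-id SS)) (sym (st-assoc (Ψ Q) (Ψ⁻ Q) SS)) ⟩
      (Ψ Q [ Ψ⁻ Q ]ₛ) [ SS ]ₛ
        ≈⟨ ≈-st-l (ΨΨ⁻ Q) SS ⟩
      SS
        ≈⟨ Φ-Φ⁻ (t °ᵗ) ⟩
      t °ᵗ ∎

  fully-faithful :
      ((Γ : Ctx) (A : VTy) (t u : Tm Γ nothing A) → (t •ᵗ) ≈ (u •ᵗ) → t ≈ u)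
    × ((Γ : Ctx) (A : VTy) (t : Tm (Γ •c) nothing (A •)) → Σ (Tm Γ nothing A) λ u → t ≈ (u •ᵗ))
    × ((Γ : Ctx) (P Q : CTy) (t u : Tm Γ (just P) ⌜ Q ⌝) → (t °ᵗ) ≈ (u °ᵗ) → t ≈ u)
    × ((Γ : Ctx) (P Q : CTy) (t : Tm (Γ •c) (just (Q °)) ⌜ P ° ⌝) → Σ (Tm Γ (just P) ⌜ Q ⌝) λ u → t ≈ (u °ᵗ))
  fully-faithful =
      (λ _ _ → faith•) , (λ _ _ → full•) , (λ _ _ _ → faith°) , (λ _ _ _ → full°)

ccon-°-self : ∀ n → Translation._° (ccon n) (ccon n) ≡ I
ccon-°-self n with n ≡ᵇ n in eq
... | true = refl
... | false = ⊥-elim (subst T eq (≡⇒≡ᵇ n n refl))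

ccon-°° : ∀ n m → Translation._° (ccon n) (Translation._° (ccon n) (ccon m)) ≡ ccon m
ccon-°° n m with n ≡ᵇ m in eq
... | true = cong ccon (≡ᵇ⇒≡ n m (subst T (sym eq) tt))
... | false rewrite eq = refl

theorem5p5 : (R : CTy) → ((Σ ℕ λ n → R ≡ ccon n) ⊎ R ≡ I) →
    let open Translation R in
      ((Γ : Ctx) (A : VTy) (t u : Tm Γ nothing A) → (t •ᵗ) ≈ (u •ᵗ) → t ≈ u)
    × ((Γ : Ctx) (A : VTy) (t : Tm (Γ •c) nothing (A •)) → Σ (Tm Γ nothing A) λ u → t ≈ (u •ᵗ))
    × ((Γ : Ctx) (P Q : CTy) (t u : Tm Γ (just P) ⌜ Q ⌝) → (t °ᵗ) ≈ (u °ᵗ) → t ≈ u)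
    × ((Γ : Ctx) (P Q : CTy) (t : Tm (Γ •c) (just (Q °)) ⌜ P ° ⌝) → Σ (Tm Γ (just P) ⌜ Q ⌝) λ u → t ≈ (u °ᵗ))
theorem5p5 .(ccon n) (inj₁ (n , refl)) = Involution.fully-faithful (ccon n) (ccon-°-self n) (ccon-°° n)
theorem5p5 .I (inj₂ refl) = Involution.fully-faithful I refl (λ _ → refl)
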